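{- Let $H\in\mathbb{F}_q[x]$ and let $D_1,D_2$ be monic divisors of $H$. Then $$\phi(D_2)\,\eta\!\left(\frac{H}{D_2},D_1\right)=\phi(D_1)\,\eta\!\left(\frac{H}{D_1},D_2\right).$$
   Context: Let $\mathbb{F}_q$ be a finite field with $q$ elements and fix a non-trivial homomorphism $\lambda:(\mathbb{F}_q,+)\to\mathbb{C}^*$. For nonzero $M\in\mathbb{F}_q[x]$ of degree $m\ge1$ and $A\in\mathbb{F}_q[x]$, let $t_M(A)$ be the coefficient of $x^{m-1}$ in the remainder of $A$ on division by $M$ (if $m=0$, $t_M(A)=0$), and $E(G,M)(A)=\lambda(t_M(GA))$. For nonzero $D$, $\eta(G,D)=\sum_{R}E(G,D)(R)$, where $R$ runs over a complete residue system modulo $D$ with $\gcd(R,D)=1$. $|A|=q^{\deg A}$, and $\phi(D)=|D|\prod_{P}(1-|P|^{ -1})$, the product over monic irreducible $P$ dividing $D$ (the number of polynomials of degree $<\deg D$ coprime to $D$). -}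

module Defs where

open import Level using (Level; _⊔_) renaming (suc to lsuc)
open import Data.Nat using (ℕ; zero; suc; _≡ᵇ_)
open import Data.List using (List; []; _∷_; _∷ʳ_; map; foldr; length)
open import Data.List.Relation.Unary.All using (All)
open import Data.List.Relation.Unary.Any using (Any)
open import Data.List.Relation.Unary.AllPairs using (AllPairs)
open import Data.Vec using (Vec; []; _∷_; zipWith; replicate; init; last; toList)
open import Data.Product using (Σ; _,_)
open import Relation.Nullary using (¬_)
open import Relation.Binary.PropositionalEquality using (_≡_)
open import Algebra.Bundles using (CommutativeRing)

module RingOps {c ℓ} (R : CommutativeRing c ℓ) where
  open CommutativeRing R

  natMul : ℕ → Carrier → Carrier
  natMul zero    x = 0#
  natMul (suc n) x = x + natMul n x

  sumR : List Carrier → Carrier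
  sumR = foldr _+_ 0#

  evalR : List Carrier → Carrier → Carrier
  evalR []       x = 0#
  evalR (a ∷ as) x = a + x * evalR as x

-- A finite field F_q (q = length elements)

record FiniteField (c ℓ : Level) : Set (lsuc (c ⊔ ℓ)) where
  field
    commRing : CommutativeRing c ℓ
  open CommutativeRing commRing public
  field
    0≉1       : ¬ (0# ≈ 1#)
    inverse   : ∀ x → ¬ (x ≈ 0#) → Σ Carrier (λ y → x * y ≈ 1#)
    elements  : List Carrier
    complete  : ∀ x → Any (x ≈_) elements
    distinct  : AllPairs (λ a b → ¬ (a ≈ b)) elements

record ACF0 (c ℓ : Level) : Set (lsuc (c ⊔ ℓ)) where
  field
    commRing : CommutativeRing c ℓ
  open CommutativeRing commRing public
  open RingOps commRing public
  field
    0≉1        : ¬ (0# ≈ 1#)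
    inverse    : ∀ x → ¬ (x ≈ 0#) → Σ Carrier (λ y → x * y ≈ 1#)
    char0      : ∀ n → natMul n 1# ≈ 0# → n ≡ 0
    algClosed  : ∀ a₀ as a → ¬ (a ≈ 0#) →
                 Σ Carrier (λ x → evalR ((a₀ ∷ as) ∷ʳ a) x ≈ 0#)

-- Polynomials over F, as coefficient lists (constant term first)

module Poly {c ℓ} (F : FiniteField c ℓ) where
  open FiniteField F

  Pol : Set c
  Pol = List Carrier

  coeff : Pol → ℕ → Carrier
  coeff []       n       = 0#
  coeff (a ∷ p)  zero    = a
  coeff (a ∷ p)  (suc n) = coeff p n

  -- equality of polynomials (coefficientwise, trailing zeros irrelevant)
  _≈ₚ_ : Pol → Pol → Set ℓ
  P ≈ₚ Q = ∀ n → coeff P n ≈ coeff Q n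

  _+ₚ_ : Pol → Pol → Pol
  []      +ₚ q       = q
  (a ∷ p) +ₚ []      = a ∷ p
  (a ∷ p) +ₚ (b ∷ q) = (a + b) ∷ (p +ₚ q)

  scaleₚ : Carrier → Pol → Pol
  scaleₚ a = map (a *_)

  _*ₚ_ : Pol → Pol → Pol
  []      *ₚ q = []
  (a ∷ p) *ₚ q = scaleₚ a q +ₚ (0# ∷ (p *ₚ q))

  -ₚ_ : Pol → Pol
  -ₚ_ = map (-_)

  _-ₚ_ : Pol → Pol → Pol
  p -ₚ q = p +ₚ (-ₚ q)

  1ₚ : Pol
  1ₚ = 1# ∷ []

  _∣ₚ_ : Pol → Pol → Set (c ⊔ ℓ)
  C ∣ₚ A = Σ Pol (λ Q → (C *ₚ Q) ≈ₚ A)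

  Coprime : Pol → Pol → Set (c ⊔ ℓ)
  Coprime A D = ∀ C → C ∣ₚ A → C ∣ₚ D → C ∣ₚ 1ₚ

  -- the monic polynomial of degree m with lower coefficients v:
  -- v₀ + v₁ x + ... + v_{m-1} x^{m-1} + x^m
  monic : ∀ {m} → Vec Carrier m → Pol
  monic v = toList v ∷ʳ 1#

  -- remainder modulo monic v of (a + x·r), where r is a remainder (deg < m)
  reduce : ∀ {m} → Vec Carrier m → Carrier → Vec Carrier m → Vec Carrier m
  reduce {zero}  v a r = []
  reduce {suc k} v a r = zipWith (λ b w → b - last r * w) (a ∷ init r) v

  -- remainder of A on division by monic v, as its m coefficients
  rem : ∀ {m} → Vec Carrier m → Pol → Vec Carrier m
  rem v []      = replicate _ 0#
  rem v (a ∷ A) = reduce v a (rem v A)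

  -- t_M(A): coefficient of x^{m-1} in the remainder of A mod M (0 if m = 0)
  t : ∀ {m} → Vec Carrier m → Pol → Carrier
  t {zero}  v A = 0#
  t {suc k} v A = last (rem v A)

  record ReducedResidueSystem {m} (v : Vec Carrier m) (Rs : List Pol) : Set (c ⊔ ℓ) where
    field
      coprime     : All (λ R → Coprime R (monic v)) Rs
      covers      : ∀ A → Coprime A (monic v) → Any (λ R → monic v ∣ₚ (A -ₚ R)) Rs
      incongruent : AllPairs (λ R S → ¬ (monic v ∣ₚ (R -ₚ S))) Rs

record AddChar {c ℓ c' ℓ'} (F : FiniteField c ℓ) (K : ACF0 c' ℓ') : Set (c ⊔ ℓ ⊔ c' ⊔ ℓ') where
  private
    module F = FiniteField F
    module K = ACF0 K
  field
    χ          : F.Carrier → K.Carrier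
    χ-cong     : ∀ {a b} → a F.≈ b → χ a K.≈ χ b
    χ-hom      : ∀ a b → χ (a F.+ b) K.≈ (χ a K.* χ b)
    χ-unit     : ∀ a → ¬ (χ a K.≈ K.0#)
    nontrivial : Σ F.Carrier (λ a → ¬ (χ a K.≈ K.1#))

module Sums {c ℓ c' ℓ'} (F : FiniteField c ℓ) (K : ACF0 c' ℓ') (λ' : AddChar F K) where
  open Poly F
  open AddChar λ'

  E : Pol → ∀ {m} → Vec (FiniteField.Carrier F) m → Pol → ACF0.Carrier K
  E G v A = χ (t v (G *ₚ A))

  η : Pol → ∀ {m} → Vec (FiniteField.Carrier F) m → List Pol → ACF0.Carrier K
  η G v Rs = ACF0.sumR K (map (E G v) Rs)

  -- φ(D) = number of residues coprime to D = length of a reduced residue system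
  φ : List Pol → ℕ
  φ Rs = length Rs

{-# OPTIONS --safe #-}
-- Write H = M₁ Q₁ = M₂ Q₂ with M₁, M₂ monic.  The key identity is t_{M₁}(Q₂ X) = t_{M₂}(Q₁ X): by
-- uniqueness of division by the monic M₁ M₂, the remainders r₁ of Q₂ X mod M₁ and r₂ of Q₁ X mod M₂
-- satisfy M₂ r₁ = M₁ r₂, and comparing coefficients in degree deg M₁ + deg M₂ - 1 gives the claim.
-- So g = E(Q₂, M₁) = E(Q₁, M₂) is periodic modulo M₁ and modulo M₂, hence modulo D = gcd(M₁, M₂).
-- Since units modulo D lift to units modulo any multiple M of D, all units mod D have the same number cᵢ
-- of lifts in a reduced residue system mod Mᵢ.  Double counting the pairs (R, S) of reduced residues mod
-- M₁ and mod M₂ with R ≡ S (mod D) yields c₂ η(Q₂, M₁) = c₁ η(Q₁, M₂) and c₂ φ(M₁) = c₁ φ(M₂), and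
-- c₁ ≠ 0 can be cancelled in characteristic 0.
module Submission where

open import Defs
open import Level using (Level; _⊔_)
open import Data.Nat as ℕ using (ℕ; zero; suc; _≤_; _<_; z≤n; s≤s; pred)
import Data.Nat.Properties as ℕ
import Data.Vec.Properties as Vec
import Data.List.Properties as List
open import Data.Nat.Induction using (<-wellFounded)
open import Induction.WellFounded using (Acc; acc)
open import Data.List as List using (List; []; _∷_; _∷ʳ_; map; length; filter)
open import Data.List.Relation.Unary.All as All using (All; []; _∷_)
import Data.List.Relation.Unary.All.Properties as All
open import Data.List.Relation.Unary.Any as Any using (Any; here; there)
import Data.List.Relation.Unary.Any.Properties as Any
open import Data.List.Relation.Unary.AllPairs as AllPairs using (AllPairs; []; _∷_)
import Data.List.Relation.Unary.AllPairs.Properties as AllPairs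
open import Data.Vec as Vec using (Vec; []; _∷_; toList)
open import Data.Product using (∃; _×_; _,_; proj₁; proj₂)
open import Data.Empty using (⊥-elim)
open import Relation.Nullary using (¬_; Dec; yes; no; does)
open import Relation.Binary.Bundles using (Setoid)
open import Relation.Binary.PropositionalEquality as ≡ using (_≡_)
open import Relation.Binary.Definitions using (Decidable)
open import Algebra.Bundles using (CommutativeRing)
open import Data.Bool using (true; false; if_then_else_)

module CommutativeRingCongruence {c ℓ} (R : CommutativeRing c ℓ) where
  open CommutativeRing R
  open import Relation.Binary.Reasoning.MultiSetoid
  open import Algebra.Properties.Semiring.Divisibility semiring public
  open import Algebra.Properties.Ring ring using (-‿distribˡ-*; //-rightDividesˡ; //-rightDividesʳ)
  open import Algebra.Solver.Ring.NaturalCoefficients.Default commutativeSemiring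

  x≈y+z⇒x-y≈z : ∀ {x y z} → x ≈ y + z → x - y ≈ z
  x≈y+z⇒x-y≈z {x} {y} {z} e = trans (+-congʳ (trans e (+-comm y z))) (//-rightDividesʳ y z)

  x-y≈z⇒x≈y+z : ∀ {x y z} → x - y ≈ z → x ≈ y + z
  x-y≈z⇒x≈y+z {x} {y} {z} e = trans (sym (//-rightDividesˡ y x)) (trans (+-comm _ _) (+-congˡ e))

  ∣-+ : ∀ {m x y} → m ∣ x → m ∣ y → m ∣ x + y
  ∣-+ (p , e) (q , f) = p + q , trans (distribʳ _ p q) (+-cong e f)

  ∣-* : ∀ {m x} y → m ∣ x → m ∣ y * x
  ∣-* {m} y (p , e) = y * p , trans (*-assoc y p m) (*-congˡ e)

  infix 4 _≡_mod_
  record _≡_mod_ (x y m : Carrier) : Set (c ⊔ ℓ) where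
    constructor mod-by
    field
      quotient : Carrier
      equation : x ≈ y + quotient * m

  ≡mod⇒∣- : ∀ {m x y} → x ≡ y mod m → m ∣ x - y
  ≡mod⇒∣- (mod-by q e) = q , sym (x≈y+z⇒x-y≈z e)

  ∣-⇒≡mod : ∀ {m x y} → m ∣ x - y → x ≡ y mod m
  ∣-⇒≡mod (q , e) = mod-by q (x-y≈z⇒x≈y+z (sym e))

  +*≡mod : ∀ m x q → x + q * m ≡ x mod m
  +*≡mod m x q = mod-by q refl

  *≡mod-0 : ∀ m x → x * m ≡ 0# mod m
  *≡mod-0 m x = mod-by x (sym (+-identityˡ _))

  y≈y+0*m : ∀ y m → y ≈ y + 0# * m
  y≈y+0*m y m = sym (trans (+-congˡ (zeroˡ m)) (+-identityʳ y))

  ≡mod-reflexive : ∀ {m x y} → x ≈ y → x ≡ y mod m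
  ≡mod-reflexive {m} {x} {y} e = mod-by 0# (trans e (y≈y+0*m y m))

  ≡mod-refl : ∀ {m x} → x ≡ x mod m
  ≡mod-refl = ≡mod-reflexive refl

  +*-cancel : ∀ y q m → (y + q * m) + - q * m ≈ y
  +*-cancel y q m = begin⟨ setoid ⟩
    (y + q * m) + - q * m  ≈⟨ solve 4 (λ y q n m → (y :+ q :* m) :+ n :* m := y :+ (q :+ n) :* m) refl y q (- q) m ⟩
    y + (q - q) * m        ≈⟨ +-congˡ (*-congʳ (-‿inverseʳ q)) ⟩
    y + 0# * m             ≈⟨ y≈y+0*m y m ⟨
    y                      ∎

  ≡mod-sym : ∀ {m x y} → x ≡ y mod m → y ≡ x mod m
  ≡mod-sym {m} {x} {y} (mod-by q e) = mod-by (- q) (sym (trans (+-congʳ e) (+*-cancel y q m)))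

  ≡mod-trans : ∀ {m x y z} → x ≡ y mod m → y ≡ z mod m → x ≡ z mod m
  ≡mod-trans {m} {x} {y} {z} (mod-by q e) (mod-by p f) = mod-by (p + q) (begin⟨ setoid ⟩
    x                       ≈⟨ e ⟩
    y + q * m               ≈⟨ +-congʳ f ⟩
    (z + p * m) + q * m     ≈⟨ solve 4 (λ z p q m → (z :+ p :* m) :+ q :* m := z :+ (p :+ q) :* m) refl z p q m ⟩
    z + (p + q) * m         ∎)

  ≡mod-resp : ∀ {m x x' y y'} → x ≈ x' → y ≈ y' → x ≡ y mod m → x' ≡ y' mod m
  ≡mod-resp ex ey (mod-by q e) = mod-by q (trans (sym ex) (trans e (+-congʳ ey)))

  ≡mod-+ : ∀ {m x y u v} → x ≡ y mod m → u ≡ v mod m → x + u ≡ y + v mod m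
  ≡mod-+ {m} {x} {y} {u} {v} (mod-by q e) (mod-by p f) = mod-by (q + p) (begin⟨ setoid ⟩
    x + u                         ≈⟨ +-cong e f ⟩
    (y + q * m) + (v + p * m)     ≈⟨ solve 5 (λ y q v p m → (y :+ q :* m) :+ (v :+ p :* m) := (y :+ v) :+ (q :+ p) :* m) refl y q v p m ⟩
    (y + v) + (q + p) * m         ∎)

  ≡mod-*ˡ : ∀ {m x y} a → x ≡ y mod m → a * x ≡ a * y mod m
  ≡mod-*ˡ {m} {x} {y} a (mod-by q e) = mod-by (a * q) (begin⟨ setoid ⟩
    a * x             ≈⟨ *-congˡ e ⟩
    a * (y + q * m)   ≈⟨ solve 4 (λ a y q m → a :* (y :+ q :* m) := a :* y :+ (a :* q) :* m) refl a y q m ⟩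
    a * y + (a * q) * m ∎)

  ≡mod-*-modulus : ∀ {m x y} a → x ≡ y mod m → a * x ≡ a * y mod (a * m)
  ≡mod-*-modulus {m} {x} {y} a (mod-by q e) = mod-by q (begin⟨ setoid ⟩
    a * x               ≈⟨ *-congˡ e ⟩
    a * (y + q * m)     ≈⟨ solve 4 (λ a y q m → a :* (y :+ q :* m) := a :* y :+ q :* (a :* m)) refl a y q m ⟩
    a * y + q * (a * m) ∎)

  ≡mod-*ʳ : ∀ {m x y} a → x ≡ y mod m → x * a ≡ y * a mod m
  ≡mod-*ʳ a d = ≡mod-resp (*-comm a _) (*-comm a _) (≡mod-*ˡ a d)

  ≡mod-∣ : ∀ {d m x y} → d ∣ m → x ≡ y mod m → x ≡ y mod d
  ≡mod-∣ {d} {m} {x} {y} (k , dk) (mod-by q e) = mod-by (q * k) (begin⟨ setoid ⟩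
    x                   ≈⟨ e ⟩
    y + q * m           ≈⟨ +-congˡ (*-congˡ (sym dk)) ⟩
    y + q * (k * d)     ≈⟨ +-congˡ (sym (*-assoc q k d)) ⟩
    y + (q * k) * d     ∎)

  ≡mod-setoid : Carrier → Setoid c (c ⊔ ℓ)
  ≡mod-setoid m = record
    { Carrier = Carrier
    ; _≈_ = λ x y → x ≡ y mod m
    ; isEquivalence = record { refl = ≡mod-refl ; sym = ≡mod-sym ; trans = ≡mod-trans } }

  ≡mod-combination : ∀ {a b d m₁ m₂ x y} → a * m₁ + b * m₂ ≈ d → x ≡ y mod d → ∃ λ z → x ≡ z mod m₁ × z ≡ y mod m₂
  ≡mod-combination {a} {b} {d} {m₁} {m₂} {x} {y} e (mod-by q x≈y+qd) = y + (q * b) * m₂ , mod-by (q * a) (begin⟨ setoid ⟩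
    x                                   ≈⟨ x≈y+qd ⟩
    y + q * d                           ≈⟨ +-congˡ (*-congˡ e) ⟨
    y + q * (a * m₁ + b * m₂)            ≈⟨ solve 6 (λ y q a b m₁ m₂ → y :+ q :* (a :* m₁ :+ b :* m₂)
                                                      := (y :+ (q :* b) :* m₂) :+ (q :* a) :* m₁) refl y q a b m₁ m₂ ⟩
    (y + (q * b) * m₂) + (q * a) * m₁    ∎) , +*≡mod m₂ y (q * b)

  record BezoutCoprime (x m : Carrier) : Set (c ⊔ ℓ) where
    constructor bezout
    field
      coeffˡ coeffʳ : Carrier
      identity : coeffˡ * x + coeffʳ * m ≈ 1#
  open BezoutCoprime public

  bezout-inverse : ∀ {x m} (b : BezoutCoprime x m) → coeffˡ b * x ≡ 1# mod m
  bezout-inverse (bezout s t st) = ≡mod-sym (mod-by t (sym st))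

  inverse⇒bezout : ∀ {x y m} → y * x ≡ 1# mod m → BezoutCoprime x m
  inverse⇒bezout {m = m} (mod-by q e) = bezout _ (- q) (trans (+-congʳ e) (+*-cancel 1# q m))

  bezoutCoprime-≡mod : ∀ {x x' m} → x ≡ x' mod m → BezoutCoprime x m → BezoutCoprime x' m
  bezoutCoprime-≡mod d b = inverse⇒bezout (≡mod-trans (≡mod-*ˡ (coeffˡ b) (≡mod-sym d)) (bezout-inverse b))

  bezoutCoprime-respʳ : ∀ {x m m'} → m ≈ m' → BezoutCoprime x m → BezoutCoprime x m'
  bezoutCoprime-respʳ e (bezout s t st) = bezout s t (trans (+-congˡ (*-congˡ (sym e))) st)

  1-bezoutCoprime : ∀ {m} → BezoutCoprime 1# m
  1-bezoutCoprime = inverse⇒bezout (≡mod-reflexive (*-identityˡ 1#))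

  bezoutCoprime-∣ : ∀ {x d m} → d ∣ m → BezoutCoprime x m → BezoutCoprime x d
  bezoutCoprime-∣ dm b = inverse⇒bezout (≡mod-∣ dm (bezout-inverse b))

  bezoutCoprime-* : ∀ {x y m} → BezoutCoprime x m → BezoutCoprime y m → BezoutCoprime (x * y) m
  bezoutCoprime-* {x} {y} {m} b b' = inverse⇒bezout (begin⟨ ≡mod-setoid m ⟩
    (s * s') * (x * y)   ≈⟨ ≡mod-reflexive (solve 4 (λ s s' x y → (s :* s') :* (x :* y) := (s :* x) :* (s' :* y)) refl s s' x y) ⟩
    (s * x) * (s' * y)   ≈⟨ ≡mod-*ʳ (s' * y) (bezout-inverse b) ⟩
    1# * (s' * y)        ≈⟨ ≡mod-*ˡ 1# (bezout-inverse b') ⟩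
    1# * 1#              ≈⟨ ≡mod-reflexive (*-identityˡ 1#) ⟩
    1#                   ∎)
    where
    s = coeffˡ b
    s' = coeffˡ b'

  bezoutCoprime-*ʳ : ∀ {x m n} → BezoutCoprime x m → BezoutCoprime x n → BezoutCoprime x (m * n)
  bezoutCoprime-*ʳ {x} {m} {n} (bezout s t st) (bezout s' t' st') =
    bezout ((s * s') * x + (s * t') * n + (t * s') * m) (t * t') (begin⟨ setoid ⟩
      ((s * s') * x + (s * t') * n + (t * s') * m) * x + (t * t') * (m * n)
        ≈⟨ solve 7 (λ s t s' t' x m n →
             ((s :* s') :* x :+ (s :* t') :* n :+ (t :* s') :* m) :* x :+ (t :* t') :* (m :* n)
               := (s :* x :+ t :* m) :* (s' :* x :+ t' :* n)) refl s t s' t' x m n ⟩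
      (s * x + t * m) * (s' * x + t' * n) ≈⟨ *-cong st st' ⟩
      1# * 1#                             ≈⟨ *-identityˡ 1# ⟩
      1#                                  ∎)

  ≡mod-cancelˡ : ∀ {u m x y} → BezoutCoprime u m → u * x ≡ u * y mod m → x ≡ y mod m
  ≡mod-cancelˡ {u} {m} {x} {y} b d = begin⟨ ≡mod-setoid m ⟩
    x              ≈⟨ ≡mod-reflexive (sym (*-identityˡ x)) ⟩
    1# * x         ≈⟨ ≡mod-*ʳ x (bezout-inverse b) ⟨
    (s * u) * x    ≈⟨ ≡mod-reflexive (*-assoc s u x) ⟩
    s * (u * x)    ≈⟨ ≡mod-*ˡ s d ⟩
    s * (u * y)    ≈⟨ ≡mod-reflexive (*-assoc s u y) ⟨
    (s * u) * y    ≈⟨ ≡mod-*ʳ y (bezout-inverse b) ⟩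
    1# * y         ≈⟨ ≡mod-reflexive (*-identityˡ y) ⟩
    y              ∎
    where
    s = coeffˡ b

  combination-∣1⇒bezoutCoprime : ∀ {a b d x m} → a * m + b * x ≈ d → d ∣ 1# → BezoutCoprime x m
  combination-∣1⇒bezoutCoprime {a} {b} {d} {x} {m} e (k , kd≈1) = bezout (k * b) (k * a) (begin⟨ setoid ⟩
    (k * b) * x + (k * a) * m  ≈⟨ solve 5 (λ k a b x m → (k :* b) :* x :+ (k :* a) :* m := k :* (a :* m :+ b :* x)) refl k a b x m ⟩
    k * (a * m + b * x)        ≈⟨ *-congˡ e ⟩
    k * d                      ≈⟨ kd≈1 ⟩
    1#                         ∎)

  bezoutCoprime⇒common-divisor-∣1 : ∀ {x m d} → BezoutCoprime x m → d ∣ x → d ∣ m → d ∣ 1#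
  bezoutCoprime⇒common-divisor-∣1 (bezout s t st) d∣x d∣m = ∣ʳ-respʳ-≈ st (∣-+ (∣-* s d∣x) (∣-* t d∣m))

  -- Chinese remaindering: u ≡ t (mod g) and u ≡ 1 (mod n).
  unit-lift-coprime : ∀ {t g n} → BezoutCoprime n g → BezoutCoprime t g →
                      ∃ λ u → BezoutCoprime u (g * n) × u ≡ t mod g
  unit-lift-coprime {t} {g} {n} (bezout a b an+bg≈1) t⊥g = u , bezoutCoprime-*ʳ u⊥g u⊥n , u≡t
    where
    u = t * (a * n) + b * g
    u≡t : u ≡ t mod g
    u≡t = begin⟨ ≡mod-setoid g ⟩
      t * (a * n) + b * g  ≈⟨ ≡mod-+ (≡mod-*ˡ t (bezout-inverse (bezout a b an+bg≈1))) (*≡mod-0 g b) ⟩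
      t * 1# + 0#          ≈⟨ ≡mod-reflexive (trans (+-identityʳ _) (*-identityʳ t)) ⟩
      t                    ∎
    u≡1 : u ≡ 1# mod n
    u≡1 = begin⟨ ≡mod-setoid n ⟩
      t * (a * n) + b * g  ≈⟨ ≡mod-+ (≡mod-reflexive (sym (*-assoc t a n))) (bezout-inverse (bezout b a (trans (+-comm _ _) an+bg≈1))) ⟩
      (t * a) * n + 1#     ≈⟨ ≡mod-+ (*≡mod-0 n (t * a)) ≡mod-refl ⟩
      0# + 1#              ≈⟨ ≡mod-reflexive (+-identityˡ 1#) ⟩
      1#                   ∎
    u⊥g = bezoutCoprime-≡mod (≡mod-sym u≡t) t⊥g
    u⊥n = bezoutCoprime-≡mod (≡mod-sym u≡1) 1-bezoutCoprime

  -- The update of Bézout coefficients in one step of Euclid's algorithm.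
  bezout-step : ∀ {a₁ b₁ d u m b r q s} → a₁ * u + b₁ * m ≈ d → u ≈ s * r → b ≈ r + q * m →
                (b₁ - (a₁ * s) * q) * m + (a₁ * s) * b ≈ d
  bezout-step {a₁} {b₁} {d} {u} {m} {b} {r} {q} {s} e u≈sr b≈r+qm = begin⟨ setoid ⟩
    (b₁ + n) * m + (a₁ * s) * b
      ≈⟨ +-congˡ (*-congˡ b≈r+qm) ⟩
    (b₁ + n) * m + (a₁ * s) * (r + q * m)
      ≈⟨ solve 7 (λ a₁ b₁ m r q s n → (b₁ :+ n) :* m :+ (a₁ :* s) :* (r :+ q :* m)
                    := (a₁ :* (s :* r) :+ b₁ :* m) :+ ((a₁ :* s) :* q :+ n) :* m) refl a₁ b₁ m r q s n ⟩
    (a₁ * (s * r) + b₁ * m) + ((a₁ * s) * q + n) * m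
      ≈⟨ +-cong (+-congʳ (*-congˡ (sym u≈sr))) (trans (*-congʳ (-‿inverseʳ _)) (zeroˡ m)) ⟩
    (a₁ * u + b₁ * m) + 0#
      ≈⟨ trans (+-identityʳ _) e ⟩
    d ∎
    where n = - ((a₁ * s) * q)

module PolynomialRing {c ℓ} (F : FiniteField c ℓ) where
  open FiniteField F
  open Poly F
  open import Relation.Binary.Reasoning.MultiSetoid
  open import Algebra.Properties.Ring ring using (-0#≈0#)

  infix 4 _≋_
  record _≋_ (P Q : Pol) : Set ℓ where
    constructor mk≋
    field coeff-≈ : P ≈ₚ Q
  open _≋_ public

  ≋-refl : ∀ {P} → P ≋ P
  ≋-refl = mk≋ λ n → refl

  ≋-reflexive : ∀ {P Q} → P ≡ Q → P ≋ Q
  ≋-reflexive ≡.refl = ≋-refl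

  ≋-sym : ∀ {P Q} → P ≋ Q → Q ≋ P
  ≋-sym (mk≋ e) = mk≋ λ n → sym (e n)

  ≋-trans : ∀ {P Q R} → P ≋ Q → Q ≋ R → P ≋ R
  ≋-trans (mk≋ e) (mk≋ f) = mk≋ λ n → trans (e n) (f n)

  ≋-setoid : Setoid c ℓ
  ≋-setoid = record
    { Carrier = Pol ; _≈_ = _≋_ ; isEquivalence = record { refl = ≋-refl ; sym = ≋-sym ; trans = ≋-trans } }

  ∷-cong : ∀ {a b P Q} → a ≈ b → P ≋ Q → (a ∷ P) ≋ (b ∷ Q)
  ∷-cong {a} {b} {P} {Q} e (mk≋ f) = mk≋ λ where
    zero    → e
    (suc n) → f n

  ∷-cong-[] : ∀ {a P} → a ≈ 0# → P ≋ [] → (a ∷ P) ≋ []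
  ∷-cong-[] {a} {P} e (mk≋ f) = mk≋ λ where
    zero    → e
    (suc n) → f n

  ∷-injective : ∀ {a b P Q} → (a ∷ P) ≋ (b ∷ Q) → a ≈ b × P ≋ Q
  ∷-injective (mk≋ e) = e 0 , mk≋ λ n → e (suc n)

  ∷-injective-[] : ∀ {a P} → (a ∷ P) ≋ [] → a ≈ 0# × P ≋ []
  ∷-injective-[] (mk≋ e) = e 0 , mk≋ λ n → e (suc n)

  _≟_ : ∀ x y → Dec (x ≈ y)
  x ≟ y = decide elements distinct (complete x) (complete y)
    where
    apart : ∀ {e y es} → All (λ b → ¬ (e ≈ b)) es → Any (y ≈_) es → ¬ (e ≈ y)
    apart (e≉b ∷ _) (here y≈b) e≈y = e≉b (trans e≈y y≈b)
    apart (_ ∷ e≉bs) (there y∈) e≈y = apart e≉bs y∈ e≈y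
    decide : ∀ {x y} es → AllPairs (λ a b → ¬ (a ≈ b)) es → Any (x ≈_) es → Any (y ≈_) es → Dec (x ≈ y)
    decide (e ∷ es) _ (here x≈e) (here y≈e) = yes (trans x≈e (sym y≈e))
    decide (e ∷ es) (e≉ ∷ _) (here x≈e) (there y∈) = no λ x≈y → apart e≉ y∈ (trans (sym x≈e) x≈y)
    decide (e ∷ es) (e≉ ∷ _) (there x∈) (here y≈e) = no λ x≈y → apart e≉ x∈ (trans (sym y≈e) (sym x≈y))
    decide (e ∷ es) (_ ∷ distinct) (there x∈) (there y∈) = decide es distinct x∈ y∈

  ≋[]? : ∀ P → Dec (P ≋ [])
  ≋[]? [] = yes ≋-refl
  ≋[]? (a ∷ P) with a ≟ 0# | ≋[]? P
  ... | yes a≈0 | yes P≋[] = yes (∷-cong-[] a≈0 P≋[])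
  ... | no a≉0 | _ = no λ e → a≉0 (proj₁ (∷-injective-[] e))
  ... | yes _ | no P≉[] = no λ e → P≉[] (proj₂ (∷-injective-[] e))

  coeff-+ : ∀ P Q n → coeff (P +ₚ Q) n ≈ coeff P n + coeff Q n
  coeff-+ [] Q n = sym (+-identityˡ _)
  coeff-+ (a ∷ P) [] n = sym (+-identityʳ _)
  coeff-+ (a ∷ P) (b ∷ Q) zero = refl
  coeff-+ (a ∷ P) (b ∷ Q) (suc n) = coeff-+ P Q n

  coeff-scale : ∀ a P n → coeff (scaleₚ a P) n ≈ a * coeff P n
  coeff-scale a [] n = sym (zeroʳ a)
  coeff-scale a (b ∷ P) zero = refl
  coeff-scale a (b ∷ P) (suc n) = coeff-scale a P n

  coeff-neg : ∀ P n → coeff (-ₚ P) n ≈ - coeff P n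
  coeff-neg [] n = sym -0#≈0#
  coeff-neg (b ∷ P) zero = refl
  coeff-neg (b ∷ P) (suc n) = coeff-neg P n

  +ₚ-cong : ∀ {P P' Q Q'} → P ≋ P' → Q ≋ Q' → (P +ₚ Q) ≋ (P' +ₚ Q')
  +ₚ-cong {P} {P'} {Q} {Q'} (mk≋ e) (mk≋ f) = mk≋ λ n → begin⟨ setoid ⟩
    coeff (P +ₚ Q) n          ≈⟨ coeff-+ P Q n ⟩
    coeff P n + coeff Q n     ≈⟨ +-cong (e n) (f n) ⟩
    coeff P' n + coeff Q' n   ≈⟨ coeff-+ P' Q' n ⟨
    coeff (P' +ₚ Q') n        ∎

  scaleₚ-cong : ∀ {a b P Q} → a ≈ b → P ≋ Q → scaleₚ a P ≋ scaleₚ b Q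
  scaleₚ-cong {a} {b} {P} {Q} e (mk≋ f) = mk≋ λ n → begin⟨ setoid ⟩
    coeff (scaleₚ a P) n   ≈⟨ coeff-scale a P n ⟩
    a * coeff P n          ≈⟨ *-cong e (f n) ⟩
    b * coeff Q n          ≈⟨ coeff-scale b Q n ⟨
    coeff (scaleₚ b Q) n   ∎

  -ₚ-cong : ∀ {P Q} → P ≋ Q → (-ₚ P) ≋ (-ₚ Q)
  -ₚ-cong {P} {Q} (mk≋ e) = mk≋ λ n → trans (coeff-neg P n) (trans (-‿cong (e n)) (sym (coeff-neg Q n)))

  +ₚ-comm : ∀ P Q → (P +ₚ Q) ≋ (Q +ₚ P)
  +ₚ-comm P Q = mk≋ λ n → trans (coeff-+ P Q n) (trans (+-comm _ _) (sym (coeff-+ Q P n)))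

  +ₚ-assoc : ∀ P Q R → ((P +ₚ Q) +ₚ R) ≋ (P +ₚ (Q +ₚ R))
  +ₚ-assoc P Q R = mk≋ λ n → begin⟨ setoid ⟩
    coeff ((P +ₚ Q) +ₚ R) n                ≈⟨ trans (coeff-+ (P +ₚ Q) R n) (+-congʳ (coeff-+ P Q n)) ⟩
    (coeff P n + coeff Q n) + coeff R n    ≈⟨ +-assoc _ _ _ ⟩
    coeff P n + (coeff Q n + coeff R n)    ≈⟨ trans (coeff-+ P (Q +ₚ R) n) (+-congˡ (coeff-+ Q R n)) ⟨
    coeff (P +ₚ (Q +ₚ R)) n                ∎

  +ₚ-identityʳ : ∀ P → (P +ₚ []) ≋ P
  +ₚ-identityʳ [] = ≋-refl
  +ₚ-identityʳ (a ∷ P) = ≋-refl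

  +ₚ-inverseʳ : ∀ P → (P +ₚ (-ₚ P)) ≋ []
  +ₚ-inverseʳ P = mk≋ λ n → trans (coeff-+ P (-ₚ P) n) (trans (+-congˡ (coeff-neg P n)) (-‿inverseʳ _))

  +ₚ-inverseˡ : ∀ P → ((-ₚ P) +ₚ P) ≋ []
  +ₚ-inverseˡ P = ≋-trans (+ₚ-comm (-ₚ P) P) (+ₚ-inverseʳ P)

  +ₚ-interchange : ∀ A B C D → ((A +ₚ B) +ₚ (C +ₚ D)) ≋ ((A +ₚ C) +ₚ (B +ₚ D))
  +ₚ-interchange A B C D = mk≋ λ n → begin⟨ setoid ⟩
    coeff ((A +ₚ B) +ₚ (C +ₚ D)) n
      ≈⟨ trans (coeff-+ (A +ₚ B) (C +ₚ D) n) (+-cong (coeff-+ A B n) (coeff-+ C D n)) ⟩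
    (coeff A n + coeff B n) + (coeff C n + coeff D n)
      ≈⟨ interchange _ _ _ _ ⟩
    (coeff A n + coeff C n) + (coeff B n + coeff D n)
      ≈⟨ trans (coeff-+ (A +ₚ C) (B +ₚ D) n) (+-cong (coeff-+ A C n) (coeff-+ B D n)) ⟨
    coeff ((A +ₚ C) +ₚ (B +ₚ D)) n ∎
    where open import Algebra.Properties.CommutativeSemigroup +-commutativeSemigroup using (interchange)

  0∷-+ₚ : ∀ P Q → (0# ∷ (P +ₚ Q)) ≋ ((0# ∷ P) +ₚ (0# ∷ Q))
  0∷-+ₚ P Q = ∷-cong (sym (+-identityˡ 0#)) ≋-refl

  scaleₚ-distribˡ : ∀ a P Q → scaleₚ a (P +ₚ Q) ≋ (scaleₚ a P +ₚ scaleₚ a Q)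
  scaleₚ-distribˡ a P Q = mk≋ λ n → begin⟨ setoid ⟩
    coeff (scaleₚ a (P +ₚ Q)) n           ≈⟨ trans (coeff-scale a (P +ₚ Q) n) (*-congˡ (coeff-+ P Q n)) ⟩
    a * (coeff P n + coeff Q n)           ≈⟨ distribˡ _ _ _ ⟩
    a * coeff P n + a * coeff Q n         ≈⟨ trans (coeff-+ (scaleₚ a P) (scaleₚ a Q) n) (+-cong (coeff-scale a P n) (coeff-scale a Q n)) ⟨
    coeff (scaleₚ a P +ₚ scaleₚ a Q) n    ∎

  scaleₚ-distribʳ : ∀ a b P → scaleₚ (a + b) P ≋ (scaleₚ a P +ₚ scaleₚ b P)
  scaleₚ-distribʳ a b P = mk≋ λ n → begin⟨ setoid ⟩
    coeff (scaleₚ (a + b) P) n            ≈⟨ coeff-scale (a + b) P n ⟩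
    (a + b) * coeff P n                   ≈⟨ distribʳ _ _ _ ⟩
    a * coeff P n + b * coeff P n         ≈⟨ trans (coeff-+ (scaleₚ a P) (scaleₚ b P) n) (+-cong (coeff-scale a P n) (coeff-scale b P n)) ⟨
    coeff (scaleₚ a P +ₚ scaleₚ b P) n    ∎

  scaleₚ-assoc : ∀ a b P → scaleₚ a (scaleₚ b P) ≋ scaleₚ (a * b) P
  scaleₚ-assoc a b P = mk≋ λ n → begin⟨ setoid ⟩
    coeff (scaleₚ a (scaleₚ b P)) n   ≈⟨ trans (coeff-scale a (scaleₚ b P) n) (*-congˡ (coeff-scale b P n)) ⟩
    a * (b * coeff P n)               ≈⟨ *-assoc _ _ _ ⟨
    (a * b) * coeff P n               ≈⟨ coeff-scale (a * b) P n ⟨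
    coeff (scaleₚ (a * b) P) n        ∎

  scaleₚ-zero : ∀ {a} P → a ≈ 0# → scaleₚ a P ≋ []
  scaleₚ-zero {a} P e = mk≋ λ n → trans (coeff-scale a P n) (trans (*-congʳ e) (zeroˡ _))

  scaleₚ-identity : ∀ P → scaleₚ 1# P ≋ P
  scaleₚ-identity P = mk≋ λ n → trans (coeff-scale 1# P n) (*-identityˡ _)

  *ₚ-zeroʳ : ∀ P → (P *ₚ []) ≋ []
  *ₚ-zeroʳ [] = ≋-refl
  *ₚ-zeroʳ (a ∷ P) = ∷-cong-[] refl (*ₚ-zeroʳ P)

  *ₚ-zeroˡ-≋ : ∀ {P} Q → P ≋ [] → (P *ₚ Q) ≋ []
  *ₚ-zeroˡ-≋ {[]} Q e = ≋-refl
  *ₚ-zeroˡ-≋ {a ∷ P} Q e =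
    +ₚ-cong (scaleₚ-zero Q (proj₁ (∷-injective-[] e))) (∷-cong-[] refl (*ₚ-zeroˡ-≋ Q (proj₂ (∷-injective-[] e))))

  *ₚ-congʳ : ∀ {P P'} Q → P ≋ P' → (P *ₚ Q) ≋ (P' *ₚ Q)
  *ₚ-congʳ {[]} {P'} Q e = ≋-sym (*ₚ-zeroˡ-≋ Q (≋-sym e))
  *ₚ-congʳ {a ∷ P} {[]} Q e = *ₚ-zeroˡ-≋ Q e
  *ₚ-congʳ {a ∷ P} {b ∷ P'} Q e =
    +ₚ-cong (scaleₚ-cong (proj₁ (∷-injective e)) ≋-refl) (∷-cong refl (*ₚ-congʳ Q (proj₂ (∷-injective e))))

  *ₚ-congˡ : ∀ P {Q Q'} → Q ≋ Q' → (P *ₚ Q) ≋ (P *ₚ Q')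
  *ₚ-congˡ [] e = ≋-refl
  *ₚ-congˡ (a ∷ P) e = +ₚ-cong (scaleₚ-cong refl e) (∷-cong refl (*ₚ-congˡ P e))

  *ₚ-cong : ∀ {P P' Q Q'} → P ≋ P' → Q ≋ Q' → (P *ₚ Q) ≋ (P' *ₚ Q')
  *ₚ-cong {P' = P'} {Q} e f = ≋-trans (*ₚ-congʳ Q e) (*ₚ-congˡ P' f)

  *ₚ-distribˡ : ∀ P Q R → (P *ₚ (Q +ₚ R)) ≋ ((P *ₚ Q) +ₚ (P *ₚ R))
  *ₚ-distribˡ [] Q R = ≋-refl
  *ₚ-distribˡ (a ∷ P) Q R =
    ≋-trans (+ₚ-cong (scaleₚ-distribˡ a Q R) (≋-trans (∷-cong refl (*ₚ-distribˡ P Q R)) (0∷-+ₚ (P *ₚ Q) (P *ₚ R))))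
            (+ₚ-interchange (scaleₚ a Q) (scaleₚ a R) (0# ∷ (P *ₚ Q)) (0# ∷ (P *ₚ R)))

  *ₚ-distribʳ : ∀ P Q R → ((Q +ₚ R) *ₚ P) ≋ ((Q *ₚ P) +ₚ (R *ₚ P))
  *ₚ-distribʳ P [] R = ≋-refl
  *ₚ-distribʳ P (a ∷ Q) [] = ≋-sym (+ₚ-identityʳ _)
  *ₚ-distribʳ P (a ∷ Q) (b ∷ R) =
    ≋-trans (+ₚ-cong (scaleₚ-distribʳ a b P) (≋-trans (∷-cong refl (*ₚ-distribʳ P Q R)) (0∷-+ₚ (Q *ₚ P) (R *ₚ P))))
            (+ₚ-interchange (scaleₚ a P) (scaleₚ b P) (0# ∷ (Q *ₚ P)) (0# ∷ (R *ₚ P)))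

  scaleₚ-*ₚ : ∀ a P Q → scaleₚ a (P *ₚ Q) ≋ (scaleₚ a P *ₚ Q)
  scaleₚ-*ₚ a [] Q = ≋-refl
  scaleₚ-*ₚ a (b ∷ P) Q =
    ≋-trans (scaleₚ-distribˡ a (scaleₚ b Q) (0# ∷ (P *ₚ Q)))
      (+ₚ-cong (scaleₚ-assoc a b Q) (∷-cong (zeroʳ a) (scaleₚ-*ₚ a P Q)))

  *ₚ-∷ : ∀ Q a P → (Q *ₚ (a ∷ P)) ≋ (scaleₚ a Q +ₚ (0# ∷ (Q *ₚ P)))
  *ₚ-∷ [] a P = ≋-sym (∷-cong-[] refl ≋-refl)
  *ₚ-∷ (b ∷ Q) a P = ∷-cong (+-congʳ (*-comm b a)) (begin⟨ ≋-setoid ⟩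
    scaleₚ b P +ₚ (Q *ₚ (a ∷ P))                        ≈⟨ +ₚ-cong ≋-refl (*ₚ-∷ Q a P) ⟩
    scaleₚ b P +ₚ (scaleₚ a Q +ₚ (0# ∷ (Q *ₚ P)))       ≈⟨ +ₚ-assoc (scaleₚ b P) (scaleₚ a Q) _ ⟨
    (scaleₚ b P +ₚ scaleₚ a Q) +ₚ (0# ∷ (Q *ₚ P))       ≈⟨ +ₚ-cong (+ₚ-comm (scaleₚ b P) (scaleₚ a Q)) ≋-refl ⟩
    (scaleₚ a Q +ₚ scaleₚ b P) +ₚ (0# ∷ (Q *ₚ P))       ≈⟨ +ₚ-assoc (scaleₚ a Q) (scaleₚ b P) _ ⟩
    scaleₚ a Q +ₚ (scaleₚ b P +ₚ (0# ∷ (Q *ₚ P)))       ∎)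

  *ₚ-comm : ∀ P Q → (P *ₚ Q) ≋ (Q *ₚ P)
  *ₚ-comm [] Q = ≋-sym (*ₚ-zeroʳ Q)
  *ₚ-comm (a ∷ P) Q = ≋-trans (+ₚ-cong ≋-refl (∷-cong refl (*ₚ-comm P Q))) (≋-sym (*ₚ-∷ Q a P))

  *ₚ-assoc : ∀ P Q R → ((P *ₚ Q) *ₚ R) ≋ (P *ₚ (Q *ₚ R))
  *ₚ-assoc [] Q R = ≋-refl
  *ₚ-assoc (a ∷ P) Q R =
    ≋-trans (*ₚ-distribʳ R (scaleₚ a Q) (0# ∷ (P *ₚ Q)))
      (+ₚ-cong (≋-sym (scaleₚ-*ₚ a Q R))
        (+ₚ-cong (scaleₚ-zero R refl) (∷-cong refl (*ₚ-assoc P Q R))))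

  +ₚ-0∷[] : ∀ P → (P +ₚ (0# ∷ [])) ≋ P
  +ₚ-0∷[] [] = ∷-cong-[] refl ≋-refl
  +ₚ-0∷[] (a ∷ P) = ∷-cong (+-identityʳ a) (+ₚ-identityʳ P)

  *ₚ-identityˡ : ∀ P → (1ₚ *ₚ P) ≋ P
  *ₚ-identityˡ P = ≋-trans (+ₚ-cong (scaleₚ-identity P) ≋-refl) (+ₚ-0∷[] P)

  polynomialRing : CommutativeRing c ℓ
  polynomialRing = record
    { Carrier = Pol ; _≈_ = _≋_ ; _+_ = _+ₚ_ ; _*_ = _*ₚ_ ; -_ = -ₚ_ ; 0# = [] ; 1# = 1ₚ
    ; isCommutativeRing = record
      { isRing = record
        { +-isAbelianGroup = record
          { isGroup = record
            { isMonoid = record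
              { isSemigroup = record
                { isMagma = record
                  { isEquivalence = Setoid.isEquivalence ≋-setoid
                  ; ∙-cong = +ₚ-cong }
                ; assoc = +ₚ-assoc }
              ; identity = (λ P → ≋-refl) , +ₚ-identityʳ }
            ; inverse = +ₚ-inverseˡ , +ₚ-inverseʳ
            ; ⁻¹-cong = -ₚ-cong }
          ; comm = +ₚ-comm }
        ; *-cong = *ₚ-cong
        ; *-assoc = *ₚ-assoc
        ; *-identity = *ₚ-identityˡ , (λ P → ≋-trans (*ₚ-comm P 1ₚ) (*ₚ-identityˡ P))
        ; distrib = *ₚ-distribˡ , *ₚ-distribʳ }
      ; *-comm = *ₚ-comm } }

module DegreeBound {c ℓ} (F : FiniteField c ℓ) where
  open FiniteField F
  open Poly F
  open PolynomialRing F
  open import Relation.Binary.Reasoning.MultiSetoid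
  open import Algebra.Properties.Ring ring using (-0#≈0#)

  record DegreeBelow (k : ℕ) (P : Pol) : Set ℓ where
    constructor degree<
    field vanishes : ∀ j → k ≤ j → coeff P j ≈ 0#
  open DegreeBelow public

  degreeBelow-mono : ∀ {k k' P} → k ≤ k' → DegreeBelow k P → DegreeBelow k' P
  degreeBelow-mono k≤k' (degree< v) = degree< λ j k'≤j → v j (ℕ.≤-trans k≤k' k'≤j)

  degreeBelow-resp : ∀ {k P Q} → P ≋ Q → DegreeBelow k P → DegreeBelow k Q
  degreeBelow-resp (mk≋ e) (degree< v) = degree< λ j k≤j → trans (sym (e j)) (v j k≤j)

  degreeBelow-0 : ∀ {P} → DegreeBelow 0 P → P ≋ []
  degreeBelow-0 (degree< v) = mk≋ λ j → v j z≤n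

  degreeBelow-length : ∀ P → DegreeBelow (length P) P
  degreeBelow-length P = degree< (go P)
    where
    go : ∀ P j → length P ≤ j → coeff P j ≈ 0#
    go [] j _ = refl
    go (a ∷ P) (suc j) (s≤s le) = go P j le

  degreeBelow-toList : ∀ {m} (r : Vec Carrier m) → DegreeBelow m (toList r)
  degreeBelow-toList r = ≡.subst (λ k → DegreeBelow k (toList r)) (Vec.length-toList r) (degreeBelow-length (toList r))

  degreeBelow-+ : ∀ {k P Q} → DegreeBelow k P → DegreeBelow k Q → DegreeBelow k (P +ₚ Q)
  degreeBelow-+ {k} {P} {Q} (degree< v) (degree< w) =
    degree< λ j le → trans (coeff-+ P Q j) (trans (+-cong (v j le) (w j le)) (+-identityˡ 0#))

  degreeBelow-neg : ∀ {k P} → DegreeBelow k P → DegreeBelow k (-ₚ P)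
  degreeBelow-neg {k} {P} (degree< v) = degree< λ j le → trans (coeff-neg P j) (trans (-‿cong (v j le)) -0#≈0#)

  degreeBelow-scale : ∀ {k} a {P} → DegreeBelow k P → DegreeBelow k (scaleₚ a P)
  degreeBelow-scale a {P} (degree< v) = degree< λ j le → trans (coeff-scale a P j) (trans (*-congˡ (v j le)) (zeroʳ a))

  degreeBelow-pred : ∀ {k P} → coeff P k ≈ 0# → DegreeBelow (suc k) P → DegreeBelow k P
  degreeBelow-pred {k} {P} z (degree< v) = degree< go
    where
    go : ∀ j → k ≤ j → coeff P j ≈ 0#
    go j k≤j with j ℕ.≟ k
    ... | yes ≡.refl = z
    ... | no j≢k = v j (ℕ.≤∧≢⇒< k≤j (λ e → j≢k (≡.sym e)))

  degreeBelow-tail : ∀ {k a P} → DegreeBelow (suc k) (a ∷ P) → DegreeBelow k P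
  degreeBelow-tail (degree< v) = degree< λ j le → v (suc j) (s≤s le)

  coeff-monic : ∀ {m} (v : Vec Carrier m) → coeff (monic v) m ≈ 1#
  coeff-monic [] = refl
  coeff-monic (a ∷ v) = coeff-monic v

  degreeBelow-monic : ∀ {m} (v : Vec Carrier m) → DegreeBelow (suc m) (monic v)
  degreeBelow-monic v = degree< (go v)
    where
    go : ∀ {m} (v : Vec Carrier m) j → suc m ≤ j → coeff (monic v) j ≈ 0#
    go [] (suc zero) _ = refl
    go [] (suc (suc j)) _ = refl
    go (a ∷ v) (suc j) (s≤s le) = go v j le

  coeff-monic-*ₚ : ∀ {m} (v : Vec Carrier m) k Q → DegreeBelow (suc k) Q → coeff (monic v *ₚ Q) (m ℕ.+ k) ≈ coeff Q k
  coeff-monic-*ₚ [] k Q _ = begin⟨ setoid ⟩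
    coeff (scaleₚ 1# Q +ₚ (0# ∷ [])) k        ≈⟨ coeff-+ (scaleₚ 1# Q) (0# ∷ []) k ⟩
    coeff (scaleₚ 1# Q) k + coeff (0# ∷ []) k ≈⟨ +-cong (coeff-≈ (scaleₚ-identity Q) k) (coeff-0∷[] k) ⟩
    coeff Q k + 0#                            ≈⟨ +-identityʳ _ ⟩
    coeff Q k                                 ∎
    where
    coeff-0∷[] : ∀ k → coeff (0# ∷ []) k ≈ 0#
    coeff-0∷[] zero = refl
    coeff-0∷[] (suc k) = refl
  coeff-monic-*ₚ {suc m} (a ∷ v) k Q Q<k+1 = begin⟨ setoid ⟩
    coeff (scaleₚ a Q +ₚ (0# ∷ (monic v *ₚ Q))) (suc (m ℕ.+ k))    ≈⟨ coeff-+ (scaleₚ a Q) _ (suc (m ℕ.+ k)) ⟩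
    coeff (scaleₚ a Q) (suc (m ℕ.+ k)) + coeff (monic v *ₚ Q) (m ℕ.+ k)
      ≈⟨ +-cong (vanishes (degreeBelow-scale a Q<k+1) (suc (m ℕ.+ k)) (s≤s (ℕ.m≤n+m k m))) (coeff-monic-*ₚ v k Q Q<k+1) ⟩
    0# + coeff Q k                                                  ≈⟨ +-identityˡ _ ⟩
    coeff Q k                                                       ∎

  degreeBelow-monic-*ₚ : ∀ {m} (v : Vec Carrier m) {k Q} → DegreeBelow k Q → DegreeBelow (m ℕ.+ k) (monic v *ₚ Q)
  degreeBelow-monic-*ₚ [] {k} {Q} Q<k = degreeBelow-resp (≋-sym (*ₚ-identityˡ Q)) Q<k
  degreeBelow-monic-*ₚ (a ∷ v) {k} {Q} Q<k =
    degreeBelow-+ (degreeBelow-mono (ℕ.≤-trans (ℕ.m≤n+m k _) (ℕ.n≤1+n _)) (degreeBelow-scale a Q<k))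
                  (shift (degreeBelow-monic-*ₚ v Q<k))
    where
    shift : ∀ {n P} → DegreeBelow n P → DegreeBelow (suc n) (0# ∷ P)
    shift (degree< w) = degree< λ where (suc j) (s≤s le) → w j le

  degreeBelow-monic-*ₚ-cancel : ∀ {m} (v : Vec Carrier m) k Q → DegreeBelow (m ℕ.+ k) (monic v *ₚ Q) → DegreeBelow k Q
  degreeBelow-monic-*ₚ-cancel {m} v k Q MQ<m+k = go (length Q) (degreeBelow-mono (ℕ.m≤m+n (length Q) k) (degreeBelow-length Q))
    where
    go : ∀ j → DegreeBelow (j ℕ.+ k) Q → DegreeBelow k Q
    go zero Q<k = Q<k
    go (suc j) Q<j+k+1 = go j (degreeBelow-pred top≈0 Q<j+k+1)
      where
      top≈0 : coeff Q (j ℕ.+ k) ≈ 0#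
      top≈0 = trans (sym (coeff-monic-*ₚ v (j ℕ.+ k) Q Q<j+k+1))
                    (vanishes MQ<m+k (m ℕ.+ (j ℕ.+ k)) (ℕ.+-monoʳ-≤ m (ℕ.m≤n+m k j)))

  monic-*ₚ-null : ∀ {m} (v : Vec Carrier m) Q → DegreeBelow m (monic v *ₚ Q) → Q ≋ []
  monic-*ₚ-null {m} v Q MQ<m =
    degreeBelow-0 (degreeBelow-monic-*ₚ-cancel v 0 Q (≡.subst (λ k → DegreeBelow k (monic v *ₚ Q)) (≡.sym (ℕ.+-identityʳ m)) MQ<m))

  lowerCoeffs : ∀ k → Pol → Vec Carrier k
  lowerCoeffs zero P = []
  lowerCoeffs (suc k) [] = 0# ∷ lowerCoeffs k []
  lowerCoeffs (suc k) (a ∷ P) = a ∷ lowerCoeffs k P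

  degree-≤-leading-1⇒monic : ∀ k P → DegreeBelow (suc k) P → coeff P k ≈ 1# → P ≋ monic (lowerCoeffs k P)
  degree-≤-leading-1⇒monic zero [] _ 0≈1 = ⊥-elim (0≉1 0≈1)
  degree-≤-leading-1⇒monic zero (a ∷ P) P<1 a≈1 = ∷-cong a≈1 (degreeBelow-0 (degreeBelow-tail P<1))
  degree-≤-leading-1⇒monic (suc k) [] _ 0≈1 = ⊥-elim (0≉1 0≈1)
  degree-≤-leading-1⇒monic (suc k) (a ∷ P) P<k+2 e = ∷-cong refl (degree-≤-leading-1⇒monic k P (degreeBelow-tail P<k+2) e)

  monic≉[] : ∀ {n} (w : Vec Carrier n) → ¬ (monic w ≋ [])
  monic≉[] {n} w e = 0≉1 (trans (sym (coeff-≈ e n)) (coeff-monic w))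

  monic-*ₚ-monic : ∀ {m n} (v : Vec Carrier m) (w : Vec Carrier n) → ∃ λ (u : Vec Carrier (m ℕ.+ n)) → (monic v *ₚ monic w) ≋ monic u
  monic-*ₚ-monic {m} {n} v w =
    _ , degree-≤-leading-1⇒monic (m ℕ.+ n) P
          (≡.subst (λ k → DegreeBelow k P) (ℕ.+-suc m n) (degreeBelow-monic-*ₚ v (degreeBelow-monic w)))
          (trans (coeff-monic-*ₚ v n (monic w) (degreeBelow-monic w)) (coeff-monic w))
    where P = monic v *ₚ monic w

  record MonicQuotient {d n} (e : Vec Carrier d) (w : Vec Carrier n) (Q : Pol) : Set (c ⊔ ℓ) where
    field
      degree : ℕ
      lower : Vec Carrier degree
      degree-+ : d ℕ.+ degree ≡ n
      ≋monic : Q ≋ monic lower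

  monic-quotient : ∀ {d n} (e : Vec Carrier d) (w : Vec Carrier n) Q → (monic e *ₚ Q) ≋ monic w → MonicQuotient e w Q
  monic-quotient {d} {n} e w Q EQ≋W with d ℕ.≤? n
  ... | no d≰n = ⊥-elim (monic≉[] w (≋-trans (≋-sym EQ≋W) (≋-trans (*ₚ-congˡ (monic e) Q≋[]) (*ₚ-zeroʳ (monic e)))))
    where
    Q≋[] : Q ≋ []
    Q≋[] = monic-*ₚ-null e Q (degreeBelow-mono (ℕ.≰⇒> d≰n) (degreeBelow-resp (≋-sym EQ≋W) (degreeBelow-monic w)))
  ... | yes d≤n with ℕ.m≤n⇒∃[o]m+o≡n d≤n
  ...   | n' , ≡.refl = record { degree = n' ; lower = lowerCoeffs n' Q ; degree-+ = ≡.refl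
                               ; ≋monic = degree-≤-leading-1⇒monic n' Q Q<n'+1 leading }
    where
    Q<n'+1 : DegreeBelow (suc n') Q
    Q<n'+1 = degreeBelow-monic-*ₚ-cancel e (suc n') Q
               (≡.subst (λ k → DegreeBelow k (monic e *ₚ Q)) (≡.sym (ℕ.+-suc d n')) (degreeBelow-resp (≋-sym EQ≋W) (degreeBelow-monic w)))
    leading : coeff Q n' ≈ 1#
    leading = trans (sym (coeff-monic-*ₚ e n' Q Q<n'+1)) (trans (coeff-≈ EQ≋W (d ℕ.+ n')) (coeff-monic w))

  record Normalisation (m : ℕ) (r : Pol) : Set (c ⊔ ℓ) where
    field
      degree : ℕ
      degree<m : degree < m
      lead leadInv : Carrier
      lower : Vec Carrier degree
      ≋lead*monic : r ≋ ((lead ∷ []) *ₚ monic lower)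
      monic≋leadInv* : monic lower ≋ ((leadInv ∷ []) *ₚ r)

  normalise : ∀ m r → DegreeBelow m r → ¬ (r ≋ []) → Normalisation m r
  normalise zero r r<0 r≉0 = ⊥-elim (r≉0 (degreeBelow-0 r<0))
  normalise (suc k) r r<k+1 r≉0 with coeff r k ≟ 0#
  ... | yes top≈0 = let N = normalise k r (degreeBelow-pred top≈0 r<k+1) r≉0 in
                    record { Normalisation N ; degree<m = ℕ.m<n⇒m<1+n (Normalisation.degree<m N) }
  ... | no top≉0 = record
    { degree = k ; degree<m = ℕ.n<1+n k ; lead = lc ; leadInv = lc⁻¹ ; lower = lowerCoeffs k P
    ; ≋lead*monic = ≋-trans (≋-sym r≋lc*P) (≋-trans (scaleₚ-cong refl P≋monic) (≋-sym (constant-*ₚ lc _)))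
    ; monic≋leadInv* = ≋-trans (≋-sym P≋monic) (≋-sym (constant-*ₚ lc⁻¹ r)) }
    where
    lc = coeff r k
    lc⁻¹ = proj₁ (inverse lc top≉0)
    lc⁻¹*lc≈1 : lc⁻¹ * lc ≈ 1#
    lc⁻¹*lc≈1 = trans (*-comm lc⁻¹ lc) (proj₂ (inverse lc top≉0))
    P = scaleₚ lc⁻¹ r
    P≋monic : P ≋ monic (lowerCoeffs k P)
    P≋monic = degree-≤-leading-1⇒monic k P (degreeBelow-scale lc⁻¹ r<k+1) (trans (coeff-scale lc⁻¹ r k) lc⁻¹*lc≈1)
    r≋lc*P : scaleₚ lc P ≋ r
    r≋lc*P = ≋-trans (scaleₚ-assoc lc lc⁻¹ r) (≋-trans (scaleₚ-cong (proj₂ (inverse lc top≉0)) ≋-refl) (scaleₚ-identity r))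
    constant-*ₚ : ∀ a X → ((a ∷ []) *ₚ X) ≋ scaleₚ a X
    constant-*ₚ a X = +ₚ-0∷[] (scaleₚ a X)

module MonicDivision {c ℓ} (F : FiniteField c ℓ) where
  open FiniteField F
  open Poly F
  open PolynomialRing F
  open DegreeBound F
  open CommutativeRingCongruence polynomialRing
  open import Relation.Binary.Reasoning.MultiSetoid
  open import Algebra.Solver.Ring.NaturalCoefficients.Default (CommutativeRing.commutativeSemiring polynomialRing)

  remainder : ∀ {m} → Vec Carrier m → Pol → Pol
  remainder v A = toList (rem v A)

  degreeBelow-remainder : ∀ {m} (v : Vec Carrier m) A → DegreeBelow m (remainder v A)
  degreeBelow-remainder v A = degreeBelow-toList (rem v A)

  reduce-step : ∀ {m} (v r : Vec Carrier m) a →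
                ∃ λ q → (a ∷ toList r) ≋ (scaleₚ q (monic v) +ₚ toList (reduce v a r))
  reduce-step [] [] a = a , ∷-cong (sym (*-identityʳ a)) ≋-refl
  reduce-step {suc k} v r a = Vec.last r , ≋-trans (≋-reflexive (≡.cong (a ∷_) (≡.sym (init∷ʳlast r)))) (shift (a ∷ Vec.init r) v)
    where
    init∷ʳlast : ∀ {k} (r : Vec Carrier (suc k)) → toList (Vec.init r) ∷ʳ Vec.last r ≡ toList r
    init∷ʳlast (x ∷ []) = ≡.refl
    init∷ʳlast (x ∷ y ∷ xs) = ≡.cong (x ∷_) (init∷ʳlast (y ∷ xs))
    shift : ∀ {n} (u w : Vec Carrier n) →
            (toList u ∷ʳ Vec.last r) ≋ (scaleₚ (Vec.last r) (monic w) +ₚ toList (Vec.zipWith (λ b x → b - Vec.last r * x) u w))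
    shift [] [] = ∷-cong (sym (*-identityʳ _)) ≋-refl
    shift (u₀ ∷ u) (w₀ ∷ w) = ∷-cong (CommutativeRingCongruence.x-y≈z⇒x≈y+z commRing refl) (shift u w)

  divide : ∀ {m} (v : Vec Carrier m) A → A ≡ remainder v A mod monic v
  divide v [] = mod-by [] (≋-sym (≋-trans (+ₚ-identityʳ _) (replicate-0 _)))
    where
    replicate-0 : ∀ m → toList (Vec.replicate m 0#) ≋ []
    replicate-0 zero = ≋-refl
    replicate-0 (suc m) = ∷-cong-[] refl (replicate-0 m)
  divide v (a ∷ A) with divide v A | reduce-step v (rem v A) a
  ... | mod-by q A≋ | b , step = mod-by (b ∷ q) (begin⟨ ≋-setoid ⟩
    a ∷ A                                         ≈⟨ ∷-cong (sym (+-identityʳ a)) A≋ ⟩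
    (a ∷ remainder v A) +ₚ (0# ∷ (q *ₚ M))         ≈⟨ +ₚ-cong step ≋-refl ⟩
    (scaleₚ b M +ₚ r) +ₚ (0# ∷ (q *ₚ M))           ≈⟨ solve 3 (λ x r y → (x :+ r) :+ y := r :+ (x :+ y)) ≋-refl (scaleₚ b M) r (0# ∷ (q *ₚ M)) ⟩
    r +ₚ (scaleₚ b M +ₚ (0# ∷ (q *ₚ M)))           ∎)
    where
    M = monic v
    r = remainder v (a ∷ A)

  -- A multiple of a monic M of degree below deg M vanishes.
  remainder-unique : ∀ {m} (v : Vec Carrier m) {r r'} → DegreeBelow m r → DegreeBelow m r' →
                     r ≡ r' mod monic v → r ≋ r'
  remainder-unique {m} v {r} {r'} r<m r'<m (mod-by k r≋) = begin⟨ ≋-setoid ⟩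
    r                     ≈⟨ r≋ ⟩
    r' +ₚ (k *ₚ M)         ≈⟨ +ₚ-cong ≋-refl (*ₚ-congʳ M k≋0) ⟩
    r' +ₚ []               ≈⟨ +ₚ-identityʳ r' ⟩
    r'                    ∎
    where
    M = monic v
    k≋0 : k ≋ []
    k≋0 = monic-*ₚ-null v k (degreeBelow-resp (≋-trans (x≈y+z⇒x-y≈z r≋) (*ₚ-comm k M))
                                               (degreeBelow-+ r<m (degreeBelow-neg r'<m)))

  ≡mod⇒remainder≋ : ∀ {m} (v : Vec Carrier m) {X Y} → X ≡ Y mod monic v → remainder v X ≋ remainder v Y
  ≡mod⇒remainder≋ v {X} {Y} X≡Y = remainder-unique v (degreeBelow-remainder v X) (degreeBelow-remainder v Y)
    (≡mod-trans (≡mod-sym (divide v X)) (≡mod-trans X≡Y (divide v Y)))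

  remainder≋⇒≡mod : ∀ {m} (v : Vec Carrier m) {X Y} → remainder v X ≋ remainder v Y → X ≡ Y mod monic v
  remainder≋⇒≡mod v {X} {Y} e = ≡mod-trans (divide v X) (≡mod-trans (≡mod-reflexive e) (≡mod-sym (divide v Y)))

  t≈coeff-remainder : ∀ {m} (v : Vec Carrier m) A → t v A ≈ coeff (remainder v A) (pred m)
  t≈coeff-remainder [] A with rem [] A
  ... | [] = refl
  t≈coeff-remainder (x ∷ v) A = reflexive (last≡coeff (rem (x ∷ v) A))
    where
    last≡coeff : ∀ {k} (r : Vec Carrier (suc k)) → Vec.last r ≡ coeff (toList r) k
    last≡coeff (x ∷ []) = ≡.refl
    last≡coeff (x ∷ y ∷ xs) = last≡coeff (y ∷ xs)

  t-≡mod : ∀ {m} (v : Vec Carrier m) {X Y} → X ≡ Y mod monic v → t v X ≈ t v Y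
  t-≡mod {m} v {X} {Y} X≡Y =
    trans (t≈coeff-remainder v X) (trans (coeff-≈ (≡mod⇒remainder≋ v X≡Y) (pred m)) (sym (t≈coeff-remainder v Y)))

module ResidueSymmetry {c ℓ} (F : FiniteField c ℓ) where
  open FiniteField F
  open Poly F
  open PolynomialRing F
  open DegreeBound F
  open MonicDivision F
  open CommutativeRingCongruence polynomialRing
  open import Relation.Binary.Reasoning.MultiSetoid

  -- Compare the coefficients of degree deg M₁ + deg M₂ - 1 of both sides.
  coeff-pred-cross : ∀ {m₁ m₂} (v₁ : Vec Carrier m₁) (v₂ : Vec Carrier m₂) {r₁ r₂} →
                     DegreeBelow m₁ r₁ → DegreeBelow m₂ r₂ → (monic v₂ *ₚ r₁) ≋ (monic v₁ *ₚ r₂) →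
                     coeff r₁ (pred m₁) ≈ coeff r₂ (pred m₂)
  coeff-pred-cross {zero} v₁ v₂ {r₁} {r₂} r₁<0 r₂<m₂ e = trans (coeff-≈ r₁≋[] 0) (sym (coeff-≈ r₂≋[] _))
    where
    r₁≋[] = degreeBelow-0 r₁<0
    r₂≋[] : r₂ ≋ []
    r₂≋[] = monic-*ₚ-null v₁ r₂ (degree< λ j _ →
              trans (sym (coeff-≈ e j)) (coeff-≈ (≋-trans (*ₚ-congˡ (monic v₂) r₁≋[]) (*ₚ-zeroʳ (monic v₂))) j))
  coeff-pred-cross {suc k₁} {zero} v₁ v₂ r₁<m₁ r₂<0 e = sym (coeff-pred-cross v₂ v₁ r₂<0 r₁<m₁ (≋-sym e))
  coeff-pred-cross {suc k₁} {suc k₂} v₁ v₂ {r₁} {r₂} r₁<m₁ r₂<m₂ e = begin⟨ setoid ⟩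
    coeff r₁ k₁                                 ≈⟨ coeff-monic-*ₚ v₂ k₁ r₁ r₁<m₁ ⟨
    coeff (monic v₂ *ₚ r₁) (suc k₂ ℕ.+ k₁)       ≈⟨ reflexive (≡.cong (λ n → coeff (monic v₂ *ₚ r₁) (suc n)) (ℕ.+-comm k₂ k₁)) ⟩
    coeff (monic v₂ *ₚ r₁) (suc k₁ ℕ.+ k₂)       ≈⟨ coeff-≈ e (suc k₁ ℕ.+ k₂) ⟩
    coeff (monic v₁ *ₚ r₂) (suc k₁ ℕ.+ k₂)       ≈⟨ coeff-monic-*ₚ v₁ k₂ r₂ r₂<m₂ ⟩
    coeff r₂ k₂                                 ∎

  -- Both M₂ r₁ and M₁ r₂ are the remainder of H X modulo the monic polynomial M₁ M₂.
  t-swap : ∀ {m₁ m₂} (v₁ : Vec Carrier m₁) (v₂ : Vec Carrier m₂) {Q₁ Q₂ H} X →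
           (monic v₁ *ₚ Q₁) ≋ H → (monic v₂ *ₚ Q₂) ≋ H → t v₁ (Q₂ *ₚ X) ≈ t v₂ (Q₁ *ₚ X)
  t-swap {m₁} {m₂} v₁ v₂ {Q₁} {Q₂} X M₁Q₁≋H M₂Q₂≋H =
    trans (t≈coeff-remainder v₁ (Q₂ *ₚ X))
      (trans (coeff-pred-cross v₁ v₂ (degreeBelow-remainder v₁ (Q₂ *ₚ X)) (degreeBelow-remainder v₂ (Q₁ *ₚ X)) cross)
             (sym (t≈coeff-remainder v₂ (Q₁ *ₚ X))))
    where
    M₁ = monic v₁
    M₂ = monic v₂
    r₁ = remainder v₁ (Q₂ *ₚ X)
    r₂ = remainder v₂ (Q₁ *ₚ X)
    u = proj₁ (monic-*ₚ-monic v₁ v₂)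
    M₁M₂≋monic = proj₂ (monic-*ₚ-monic v₁ v₂)
    M₂Q₂X≋M₁Q₁X : (M₂ *ₚ (Q₂ *ₚ X)) ≋ (M₁ *ₚ (Q₁ *ₚ X))
    M₂Q₂X≋M₁Q₁X = ≋-trans (≋-sym (*ₚ-assoc M₂ Q₂ X))
                    (≋-trans (*ₚ-congʳ X (≋-trans M₂Q₂≋H (≋-sym M₁Q₁≋H))) (*ₚ-assoc M₁ Q₁ X))
    congruent : (M₂ *ₚ r₁) ≡ (M₁ *ₚ r₂) mod monic u
    congruent = ≡mod-∣ (∣ʳ-reflexive (≋-sym M₁M₂≋monic))
      (≡mod-trans (≡mod-∣ (∣ʳ-reflexive (*ₚ-comm M₁ M₂)) (≡mod-*-modulus M₂ (≡mod-sym (divide v₁ (Q₂ *ₚ X)))))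
        (≡mod-trans (≡mod-reflexive M₂Q₂X≋M₁Q₁X) (≡mod-*-modulus M₁ (divide v₂ (Q₁ *ₚ X)))))
    cross : (M₂ *ₚ r₁) ≋ (M₁ *ₚ r₂)
    cross = remainder-unique u
      (≡.subst (λ k → DegreeBelow k (M₂ *ₚ r₁)) (ℕ.+-comm m₂ m₁) (degreeBelow-monic-*ₚ v₂ (degreeBelow-remainder v₁ (Q₂ *ₚ X))))
      (degreeBelow-monic-*ₚ v₁ (degreeBelow-remainder v₂ (Q₁ *ₚ X)))
      congruent

module PolynomialGCD {c ℓ} (F : FiniteField c ℓ) where
  open FiniteField F
  open Poly F
  open PolynomialRing F
  open DegreeBound F
  open MonicDivision F
  open CommutativeRingCongruence polynomialRing

  record GCD {m} (v : Vec Carrier m) (B : Pol) : Set (c ⊔ ℓ) where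
    field
      degree : ℕ
      lower : Vec Carrier degree
      ∣monic : monic lower ∣ monic v
      ∣B : monic lower ∣ B
      cofactorᴹ cofactorᴮ : Pol
      combination : ((cofactorᴹ *ₚ monic v) +ₚ (cofactorᴮ *ₚ B)) ≋ monic lower

  gcd-acc : ∀ {m} → Acc _<_ m → (v : Vec Carrier m) → ∀ B → GCD v B
  gcd-acc {m} (acc rec) v B with divide v B | ≋[]? (remainder v B)
  ... | mod-by q B≋r+qM | yes r≋[] = record
    { lower = v ; ∣monic = ∣ʳ-refl ; ∣B = q , ≋-sym (≋-trans B≋r+qM (+ₚ-cong r≋[] ≋-refl))
    ; cofactorᴹ = 1ₚ ; cofactorᴮ = [] ; combination = ≋-trans (+ₚ-identityʳ _) (*ₚ-identityˡ (monic v)) }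
  ... | mod-by q B≋r+qM | no r≉[] = record
    { lower = G.lower ; ∣monic = G.∣B ; ∣B = D∣B
    ; cofactorᴹ = G.cofactorᴮ -ₚ ((G.cofactorᴹ *ₚ s) *ₚ q) ; cofactorᴮ = G.cofactorᴹ *ₚ s
    ; combination = bezout-step {a₁ = G.cofactorᴹ} {b₁ = G.cofactorᴮ} {s = s} G.combination (Normalisation.monic≋leadInv* N) B≋r+qM }
    where
    r = remainder v B
    N = normalise m r (degreeBelow-remainder v B) r≉[]
    s = Normalisation.leadInv N ∷ []
    G = gcd-acc (rec (Normalisation.degree<m N)) (Normalisation.lower N) (monic v)
    module G = GCD G
    D∣r : monic G.lower ∣ r
    D∣r = ∣ʳ-respʳ-≈ (≋-sym (Normalisation.≋lead*monic N)) (∣-* (Normalisation.lead N ∷ []) G.∣monic)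
    D∣B : monic G.lower ∣ B
    D∣B = ∣ʳ-respʳ-≈ (≋-sym B≋r+qM) (∣-+ D∣r (∣-* q G.∣B))

  gcd : ∀ {m} (v : Vec Carrier m) B → GCD v B
  gcd {m} = gcd-acc (<-wellFounded m)

  ∣ₚ⇒∣ : ∀ {C A} → C ∣ₚ A → C ∣ A
  ∣ₚ⇒∣ {C} (Q , CQ≈A) = Q , ≋-trans (*ₚ-comm Q C) (mk≋ CQ≈A)

  ∣⇒∣ₚ : ∀ {C A} → C ∣ A → C ∣ₚ A
  ∣⇒∣ₚ {C} (Q , QC≋A) = Q , coeff-≈ (≋-trans (*ₚ-comm C Q) QC≋A)

  coprime⇒bezoutCoprime : ∀ {m} (v : Vec Carrier m) {A} → Coprime A (monic v) → BezoutCoprime A (monic v)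
  coprime⇒bezoutCoprime v {A} A⊥M = combination-∣1⇒bezoutCoprime {a = G.cofactorᴹ} {b = G.cofactorᴮ} G.combination
    (∣ₚ⇒∣ {monic G.lower} (A⊥M (monic G.lower) (∣⇒∣ₚ G.∣B) (∣⇒∣ₚ G.∣monic)))
    where module G = GCD (gcd v A)

  bezoutCoprime⇒coprime : ∀ {A M} → BezoutCoprime A M → Coprime A M
  bezoutCoprime⇒coprime A⊥M C C∣A C∣M = ∣⇒∣ₚ (bezoutCoprime⇒common-divisor-∣1 A⊥M (∣ₚ⇒∣ {C} C∣A) (∣ₚ⇒∣ {C} C∣M))

  -- Move gcd(N, G) from N into G until what is left of N is coprime to G.
  unit-lift-acc : ∀ {g n} → Acc _<_ n → (gv : Vec Carrier g) (w : Vec Carrier n) → ∀ {T} → BezoutCoprime T (monic gv) →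
                  ∃ λ U → BezoutCoprime U (monic gv *ₚ monic w) × U ≡ T mod monic gv
  unit-lift-acc {g} {n} (acc rec) gv w T⊥G with gcd w (monic gv)
  ... | record { degree = zero ; lower = [] ; cofactorᴹ = a ; cofactorᴮ = b ; combination = aN+bG≋1 } =
    unit-lift-coprime (bezout a b aN+bG≋1) T⊥G
  ... | record { degree = suc d ; lower = e ; ∣monic = (Q , QE≋N) ; ∣B = E∣G } =
    U , bezoutCoprime-respʳ GEQ≋GN U⊥GEQ , ≡mod-∣ (E , ≋-trans (*ₚ-comm E G) (proj₂ GE)) (proj₂ (proj₂ lifted))
    where
    G = monic gv
    E = monic e
    GE = monic-*ₚ-monic gv e
    quotient = monic-quotient e w Q (≋-trans (*ₚ-comm E Q) QE≋N)
    open MonicQuotient quotient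
    smaller : degree < n
    smaller = ≡.subst (degree <_) degree-+ (ℕ.m<n+m degree (s≤s z≤n))
    T⊥GE : BezoutCoprime _ (monic (proj₁ GE))
    T⊥GE = bezoutCoprime-respʳ (proj₂ GE) (bezoutCoprime-*ʳ T⊥G (bezoutCoprime-∣ E∣G T⊥G))
    lifted = unit-lift-acc (rec smaller) (proj₁ GE) lower T⊥GE
    U = proj₁ lifted
    U⊥GEQ = proj₁ (proj₂ lifted)
    GEQ≋GN : (monic (proj₁ GE) *ₚ monic lower) ≋ (G *ₚ monic w)
    GEQ≋GN = begin⟨ ≋-setoid ⟩
      monic (proj₁ GE) *ₚ monic lower   ≈⟨ *ₚ-congʳ (monic lower) (proj₂ GE) ⟨
      (G *ₚ E) *ₚ monic lower           ≈⟨ *ₚ-assoc G E (monic lower) ⟩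
      G *ₚ (E *ₚ monic lower)           ≈⟨ *ₚ-congˡ G (≋-trans (*ₚ-comm Q E) (*ₚ-congˡ E ≋monic)) ⟨
      G *ₚ (Q *ₚ E)                     ≈⟨ *ₚ-congˡ G QE≋N ⟩
      G *ₚ monic w                      ∎
      where open import Relation.Binary.Reasoning.MultiSetoid

  unit-lift : ∀ {g n} (gv : Vec Carrier g) (w : Vec Carrier n) → ∀ {T} → BezoutCoprime T (monic gv) →
              ∃ λ U → BezoutCoprime U (monic gv *ₚ monic w) × U ≡ T mod monic gv
  unit-lift {n = n} = unit-lift-acc (<-wellFounded n)

module Pigeonhole {a ℓ} (S : Setoid a ℓ) where
  open Setoid S
  open import Data.List.Membership.Setoid S using (_∈_)
  open import Data.List.Relation.Unary.Unique.Setoid S using (Unique)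

  private
    remove : ∀ {x ys} → x ∈ ys → List Carrier
    remove {ys = _ ∷ ys} (here _) = ys
    remove {ys = y ∷ _} (there x∈) = y ∷ remove x∈

    length-remove : ∀ {x ys} (x∈ : x ∈ ys) → length ys ≡ suc (length (remove x∈))
    length-remove (here _) = ≡.refl
    length-remove (there x∈) = ≡.cong suc (length-remove x∈)

    ∈-remove : ∀ {x z ys} (x∈ : x ∈ ys) → z ∈ ys → ¬ x ≈ z → z ∈ remove x∈
    ∈-remove (here x≈y) (here z≈y) x≉z = ⊥-elim (x≉z (trans x≈y (sym z≈y)))
    ∈-remove (here _) (there z∈) _ = z∈
    ∈-remove (there _) (here z≈y) _ = here z≈y
    ∈-remove (there x∈) (there z∈) x≉z = there (∈-remove x∈ z∈ x≉z)

  unique-⊆⇒length-≤ : ∀ {xs ys} → Unique xs → All (_∈ ys) xs → length xs ≤ length ys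
  unique-⊆⇒length-≤ [] [] = z≤n
  unique-⊆⇒length-≤ {x ∷ xs} {ys} (x≉xs ∷ unique) (x∈ ∷ xs⊆) =
    ≡.subst (suc (length xs) ≤_) (≡.sym (length-remove x∈))
      (s≤s (unique-⊆⇒length-≤ unique (All.zipWith (λ (z∈ , x≉z) → ∈-remove x∈ z∈ x≉z) (xs⊆ , x≉xs))))

module SumsAndMultiples {c ℓ} (R : CommutativeRing c ℓ) where
  open CommutativeRing R
  open RingOps R
  open import Algebra.Properties.CommutativeSemigroup +-commutativeSemigroup using (interchange)

  sumR-cong-All : ∀ {b p} {B : Set b} {P : B → Set p} {f g : B → Carrier} {xs} → All P xs → (∀ {x} → P x → f x ≈ g x) →
                  sumR (map f xs) ≈ sumR (map g xs)
  sumR-cong-All [] f≈g = refl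
  sumR-cong-All (px ∷ pxs) f≈g = +-cong (f≈g px) (sumR-cong-All pxs f≈g)

  sumR-cong : ∀ {b} {B : Set b} {f g : B → Carrier} → (∀ x → f x ≈ g x) → ∀ xs → sumR (map f xs) ≈ sumR (map g xs)
  sumR-cong f≈g [] = refl
  sumR-cong f≈g (x ∷ xs) = +-cong (f≈g x) (sumR-cong f≈g xs)

  sumR-+ : ∀ {b} {B : Set b} (f g : B → Carrier) xs → sumR (map (λ x → f x + g x) xs) ≈ sumR (map f xs) + sumR (map g xs)
  sumR-+ f g [] = sym (+-identityʳ 0#)
  sumR-+ f g (x ∷ xs) = trans (+-congˡ (sumR-+ f g xs)) (interchange _ _ _ _)

  sumR-0 : ∀ {b} {B : Set b} (xs : List B) → sumR (map (λ _ → 0#) xs) ≈ 0#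
  sumR-0 [] = refl
  sumR-0 (x ∷ xs) = trans (+-identityˡ _) (sumR-0 xs)

  sumR-swap : ∀ {b d} {B : Set b} {D : Set d} (h : B → D → Carrier) xs ys →
              sumR (map (λ x → sumR (map (h x) ys)) xs) ≈ sumR (map (λ y → sumR (map (λ x → h x y) xs)) ys)
  sumR-swap h [] ys = sym (sumR-0 ys)
  sumR-swap h (x ∷ xs) ys = trans (+-congˡ (sumR-swap h xs ys)) (sym (sumR-+ (h x) _ ys))


  natMul-cong : ∀ n {x y} → x ≈ y → natMul n x ≈ natMul n y
  natMul-cong zero e = refl
  natMul-cong (suc n) e = +-cong e (natMul-cong n e)

  natMul-+ : ∀ a b x → natMul (a ℕ.+ b) x ≈ natMul a x + natMul b x
  natMul-+ zero b x = sym (+-identityˡ _)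
  natMul-+ (suc a) b x = trans (+-congˡ (natMul-+ a b x)) (sym (+-assoc _ _ _))

  natMul-* : ∀ a b x → natMul (a ℕ.* b) x ≈ natMul a (natMul b x)
  natMul-* zero b x = refl
  natMul-* (suc a) b x = trans (natMul-+ b (a ℕ.* b) x) (+-congˡ (natMul-* a b x))

  natMul-comm : ∀ a b x → natMul a (natMul b x) ≈ natMul b (natMul a x)
  natMul-comm a b x = trans (sym (natMul-* a b x)) (trans (reflexive (≡.cong (λ n → natMul n x) (ℕ.*-comm a b))) (natMul-* b a x))

  natMul-1# : ∀ n x → natMul n x ≈ natMul n 1# * x
  natMul-1# zero x = sym (zeroˡ x)
  natMul-1# (suc n) x = trans (+-cong (sym (*-identityˡ x)) (natMul-1# n x)) (sym (distribʳ x 1# (natMul n 1#)))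

  natMul-sumR : ∀ {b} {B : Set b} n (f : B → Carrier) xs → natMul n (sumR (map f xs)) ≈ sumR (map (λ x → natMul n (f x)) xs)
  natMul-sumR n f [] = natMul-0 n
    where
    natMul-0 : ∀ n → natMul n 0# ≈ 0#
    natMul-0 zero = refl
    natMul-0 (suc n) = trans (+-identityˡ _) (natMul-0 n)
  natMul-sumR n f (x ∷ xs) = trans (natMul-distrib n (f x) _) (+-congˡ (natMul-sumR n f xs))
    where
    natMul-distrib : ∀ n x y → natMul n (x + y) ≈ natMul n x + natMul n y
    natMul-distrib zero x y = sym (+-identityʳ 0#)
    natMul-distrib (suc n) x y = trans (+-congˡ (natMul-distrib n x y)) (interchange _ _ _ _)

  sumR-const : ∀ {b} {B : Set b} (xs : List B) y → sumR (map (λ _ → y) xs) ≈ natMul (length xs) y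
  sumR-const [] y = refl
  sumR-const (x ∷ xs) y = +-congˡ (sumR-const xs y)

module CharacteristicZero {c ℓ} (K : ACF0 c ℓ) where
  open ACF0 K
  open SumsAndMultiples commRing
  open import Relation.Binary.Reasoning.MultiSetoid

  natMul-1#-injective : ∀ a b → natMul a 1# ≈ natMul b 1# → a ≡ b
  natMul-1#-injective zero zero _ = ≡.refl
  natMul-1#-injective zero (suc b) e = ⊥-elim (ℕ.1+n≢0 (char0 (suc b) (sym e)))
  natMul-1#-injective (suc a) zero e = ⊥-elim (ℕ.1+n≢0 (char0 (suc a) e))
  natMul-1#-injective (suc a) (suc b) e = ≡.cong suc (natMul-1#-injective a b (+-cancelˡ 1# _ _ e))
    where open import Algebra.Properties.Ring ring using (+-cancelˡ)

  natMul-cancel : ∀ n {x y} → 0 < n → natMul n x ≈ natMul n y → x ≈ y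
  natMul-cancel n@(suc _) {x} {y} _ e = begin⟨ setoid ⟩
    x                   ≈⟨ *-identityˡ x ⟨
    1# * x              ≈⟨ *-congʳ n⁻¹*n≈1 ⟨
    (n⁻¹ * n1) * x      ≈⟨ *-assoc _ _ _ ⟩
    n⁻¹ * (n1 * x)      ≈⟨ *-congˡ (natMul-1# n x) ⟨
    n⁻¹ * natMul n x    ≈⟨ *-congˡ e ⟩
    n⁻¹ * natMul n y    ≈⟨ *-congˡ (natMul-1# n y) ⟩
    n⁻¹ * (n1 * y)      ≈⟨ *-assoc _ _ _ ⟨
    (n⁻¹ * n1) * y      ≈⟨ *-congʳ n⁻¹*n≈1 ⟩
    1# * y              ≈⟨ *-identityˡ y ⟩
    y                   ∎
    where
    n1 = natMul n 1#
    n1≉0 : ¬ (n1 ≈ 0#)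
    n1≉0 n1≈0 = ℕ.1+n≢0 (char0 n n1≈0)
    n⁻¹ = proj₁ (inverse n1 n1≉0)
    n⁻¹*n≈1 : n⁻¹ * n1 ≈ 1#
    n⁻¹*n≈1 = trans (*-comm _ _) (proj₂ (inverse n1 n1≉0))

  natMul-cross-cancel : ∀ {c₁ c₂ n₁ n₂ x y} → 0 < c₁ → natMul c₂ x ≈ natMul c₁ y → c₂ ℕ.* n₁ ≡ c₁ ℕ.* n₂ →
                        natMul n₂ x ≈ natMul n₁ y
  natMul-cross-cancel {c₁} {c₂} {n₁} {n₂} {x} {y} 0<c₁ c₂x≈c₁y c₂n₁≡c₁n₂ = natMul-cancel c₁ 0<c₁ (begin⟨ setoid ⟩
    natMul c₁ (natMul n₂ x)     ≈⟨ natMul-* c₁ n₂ x ⟨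
    natMul (c₁ ℕ.* n₂) x        ≈⟨ reflexive (≡.cong (λ k → natMul k x) (≡.sym c₂n₁≡c₁n₂)) ⟩
    natMul (c₂ ℕ.* n₁) x        ≈⟨ natMul-* c₂ n₁ x ⟩
    natMul c₂ (natMul n₁ x)     ≈⟨ natMul-comm c₂ n₁ x ⟩
    natMul n₁ (natMul c₂ x)     ≈⟨ natMul-cong n₁ c₂x≈c₁y ⟩
    natMul n₁ (natMul c₁ y)     ≈⟨ natMul-comm n₁ c₁ y ⟩
    natMul c₁ (natMul n₁ y)     ∎)

module FibreCounting {a ℓ₁} (S : Setoid a ℓ₁) (_≟_ : Decidable (Setoid._≈_ S)) where
  open Setoid S using () renaming (Carrier to A; _≈_ to _∼_; sym to ∼-sym)

  fibre : A → List A → List A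
  fibre x = filter (x ≟_)

  fibre-⊇ : ∀ {p} {P : A → Set p} {x ys} → Any (λ y → P y × x ∼ y) ys → Any P (fibre x ys)
  fibre-⊇ {x = x} {y ∷ ys} (here (py , x∼y)) with x ≟ y
  ... | yes _ = here py
  ... | no x≁y = ⊥-elim (x≁y x∼y)
  fibre-⊇ {x = x} {y ∷ ys} (there p) with does (x ≟ y)
  ... | true = there (fibre-⊇ p)
  ... | false = fibre-⊇ p

  fibre-nonempty : ∀ {x ys} → Any (x ∼_) ys → 0 < length (fibre x ys)
  fibre-nonempty {x} {y ∷ ys} (here x∼y) with x ≟ y
  ... | yes _ = s≤s z≤n
  ... | no x≁y = ⊥-elim (x≁y x∼y)
  fibre-nonempty {x} {y ∷ ys} (there p) with does (x ≟ y)
  ... | true = s≤s z≤n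
  ... | false = fibre-nonempty p

  module _ {c ℓ} (R : CommutativeRing c ℓ) where
    open CommutativeRing R
    open RingOps R
    open SumsAndMultiples R
    open import Relation.Binary.Reasoning.MultiSetoid

    private
      indicator : A → A → Carrier → Carrier
      indicator x y v = if does (x ≟ y) then v else 0#

      sumR-indicator : ∀ x v ys → sumR (map (λ y → indicator x y v) ys) ≈ natMul (length (fibre x ys)) v
      sumR-indicator x v [] = refl
      sumR-indicator x v (y ∷ ys) with does (x ≟ y)
      ... | true = +-congˡ (sumR-indicator x v ys)
      ... | false = trans (+-identityˡ _) (sumR-indicator x v ys)

    -- Both sides count the pairs (x, y) ∈ xs × ys with x ∼ y, weighted by the common value of g.
    fibre-sum-symmetric : (g : A → Carrier) → (∀ {x y} → x ∼ y → g x ≈ g y) → ∀ xs ys →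
                          sumR (map (λ x → natMul (length (fibre x ys)) (g x)) xs) ≈
                          sumR (map (λ y → natMul (length (fibre y xs)) (g y)) ys)
    fibre-sum-symmetric g g-resp xs ys = begin⟨ setoid ⟩
      sumR (map (λ x → natMul (length (fibre x ys)) (g x)) xs)         ≈⟨ sumR-cong (λ x → sumR-indicator x (g x) ys) xs ⟨
      sumR (map (λ x → sumR (map (λ y → indicator x y (g x)) ys)) xs)  ≈⟨ sumR-swap (λ x y → indicator x y (g x)) xs ys ⟩
      sumR (map (λ y → sumR (map (λ x → indicator x y (g x)) xs)) ys)  ≈⟨ sumR-cong (λ y → sumR-cong (λ x → flip x y) xs) ys ⟩
      sumR (map (λ y → sumR (map (λ x → indicator y x (g y)) xs)) ys)  ≈⟨ sumR-cong (λ y → sumR-indicator y (g y) xs) ys ⟩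
      sumR (map (λ y → natMul (length (fibre y xs)) (g y)) ys)         ∎
      where
      flip : ∀ x y → indicator x y (g x) ≈ indicator y x (g y)
      flip x y with x ≟ y | y ≟ x
      ... | yes x∼y | yes _ = g-resp x∼y
      ... | yes x∼y | no y≁x = ⊥-elim (y≁x (∼-sym x∼y))
      ... | no x≁y | yes y∼x = ⊥-elim (x≁y (∼-sym y∼x))
      ... | no _ | no _ = refl

module ResidueFibres {c ℓ} (F : FiniteField c ℓ) where
  open FiniteField F
  open Poly F
  open PolynomialRing F
  open DegreeBound F
  open MonicDivision F
  open PolynomialGCD F
  open CommutativeRingCongruence polynomialRing
  module P = CommutativeRing polynomialRing
  open import Algebra.Properties.Ring P.ring using (x∙y⁻¹≈ε⇒x≈y; x≈y⇒x∙y⁻¹≈ε)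

  ≡mod? : ∀ {d} (e : Vec Carrier d) X Y → Dec (X ≡ Y mod monic e)
  ≡mod? e X Y with ≋[]? (remainder e X -ₚ remainder e Y)
  ... | yes rX-rY≋0 = yes (remainder≋⇒≡mod e (x∙y⁻¹≈ε⇒x≈y _ _ rX-rY≋0))
  ... | no rX-rY≉0 = no λ X≡Y → rX-rY≉0 (x≈y⇒x∙y⁻¹≈ε (≡mod⇒remainder≋ e X≡Y))

  module _ {d} (e : Vec Carrier d) where
    open FibreCounting (≡mod-setoid (monic e)) (≡mod? e) public

  module _ {m} {v : Vec Carrier m} {Rs} (rrs : ReducedResidueSystem v Rs) where
    open ReducedResidueSystem rrs
    open import Data.List.Membership.Setoid (≡mod-setoid (monic v)) using (_∈_)
    open import Data.List.Relation.Unary.Unique.Setoid (≡mod-setoid (monic v)) using (Unique)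

    rrs-units : All (λ R → BezoutCoprime R (monic v)) Rs
    rrs-units = All.map (coprime⇒bezoutCoprime v) coprime

    rrs-unique : Unique Rs
    rrs-unique = AllPairs.map (λ ¬M∣R-S R≡S → ¬M∣R-S (∣⇒∣ₚ (≡mod⇒∣- R≡S))) incongruent

    rrs-complete : ∀ {A} → BezoutCoprime A (monic v) → A ∈ Rs
    rrs-complete {A} A⊥M = Any.map (λ M∣A-R → ∣-⇒≡mod (∣ₚ⇒∣ M∣A-R)) (covers A (bezoutCoprime⇒coprime A⊥M))

    -- Multiplication by a unit U ≡ R' R⁻¹ (mod D), lifted to a unit mod M, maps the fibre over R into the fibre over R'.
    fibre-length-≤ : ∀ {d} (e : Vec Carrier d) → monic e ∣ monic v → ∀ {R R'} →
                     BezoutCoprime R (monic e) → BezoutCoprime R' (monic e) → length (fibre e R Rs) ≤ length (fibre e R' Rs)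
    fibre-length-≤ e (k , kD≋M) {R} {R'} R⊥D R'⊥D =
      ≡.subst (_≤ length (fibre e R' Rs)) (List.length-map (U *ₚ_) (fibre e R Rs))
        (Pigeonhole.unique-⊆⇒length-≤ (≡mod-setoid M)
          (AllPairs.map⁺ (AllPairs.map (λ S≢S' US≡US' → S≢S' (≡mod-cancelˡ U⊥M US≡US')) (AllPairs.filter⁺ (≡mod? e R) rrs-unique)))
          (All.map⁺ (All.map image-in-fibre (All.zip (All.all-filter (≡mod? e R) Rs , All.filter⁺ (≡mod? e R) rrs-units)))))
      where
      D = monic e
      M = monic v
      s = coeffˡ R⊥D
      s⊥D : BezoutCoprime s D
      s⊥D = inverse⇒bezout {y = R} (≡mod-resp (*ₚ-comm s R) ≋-refl (bezout-inverse R⊥D))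
      cofactor = monic-quotient e v k (≋-trans (*ₚ-comm D k) kD≋M)
      lifted = unit-lift e (MonicQuotient.lower cofactor) (bezoutCoprime-* R'⊥D s⊥D)
      U = proj₁ lifted
      U⊥M : BezoutCoprime U M
      U⊥M = bezoutCoprime-respʳ (≋-trans (*ₚ-congˡ D (≋-sym (MonicQuotient.≋monic cofactor))) (≋-trans (*ₚ-comm D k) kD≋M))
                                (proj₁ (proj₂ lifted))
      image-in-fibre : ∀ {S} → R ≡ S mod D × BezoutCoprime S M → Any (λ S' → U *ₚ S ≡ S' mod M) (fibre e R' Rs)
      image-in-fibre {S} (R≡S , S⊥M) = fibre-⊇ e (Any.map (λ US≡S' → US≡S' , R'≡ US≡S') (rrs-complete (bezoutCoprime-* U⊥M S⊥M)))
        where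
        R'≡ : ∀ {S'} → U *ₚ S ≡ S' mod M → R' ≡ S' mod D
        R'≡ {S'} US≡S' = begin⟨ ≡mod-setoid D ⟩
          R'                  ≈⟨ ≡mod-reflexive (≋-sym (P.*-identityʳ R')) ⟩
          R' *ₚ 1ₚ             ≈⟨ ≡mod-*ˡ R' (bezout-inverse R⊥D) ⟨
          R' *ₚ (s *ₚ R)        ≈⟨ ≡mod-reflexive (≋-sym (*ₚ-assoc R' s R)) ⟩
          (R' *ₚ s) *ₚ R        ≈⟨ ≡mod-*ʳ R (proj₂ (proj₂ lifted)) ⟨
          U *ₚ R               ≈⟨ ≡mod-*ˡ U R≡S ⟩
          U *ₚ S               ≈⟨ ≡mod-∣ (k , kD≋M) US≡S' ⟩
          S'                  ∎
          where open import Relation.Binary.Reasoning.MultiSetoid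

    fibre-length-constant : ∀ {d} (e : Vec Carrier d) → monic e ∣ monic v → ∀ {R R'} →
                            BezoutCoprime R (monic e) → BezoutCoprime R' (monic e) → length (fibre e R Rs) ≡ length (fibre e R' Rs)
    fibre-length-constant e D∣M R⊥D R'⊥D = ℕ.≤-antisym (fibre-length-≤ e D∣M R⊥D R'⊥D) (fibre-length-≤ e D∣M R'⊥D R⊥D)

module ReducedResidueSums {c ℓ c' ℓ'} (F : FiniteField c ℓ) (K : ACF0 c' ℓ') where
  open FiniteField F using (Carrier)
  open Poly F
  open PolynomialGCD F
  open ResidueFibres F
  open CommutativeRingCongruence (PolynomialRing.polynomialRing F)
  open ACF0 K using (_≈_; trans; sym; refl; 1#; natMul; sumR; commRing) renaming (Carrier to Kᶜ)
  open SumsAndMultiples commRing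
  open CharacteristicZero K
  open import Relation.Binary.Reasoning.MultiSetoid

  module _ {m₁ m₂} {v₁ : Vec Carrier m₁} {v₂ : Vec Carrier m₂} {Rs₁ Rs₂}
           (rrs₁ : ReducedResidueSystem v₁ Rs₁) (rrs₂ : ReducedResidueSystem v₂ Rs₂) (G : GCD v₁ (monic v₂)) where
    open GCD G renaming (lower to e)

    private
      c₁ = length (fibre e 1ₚ Rs₁)
      c₂ = length (fibre e 1ₚ Rs₂)

    periodic-gcd : ∀ {h : Pol → Kᶜ} → (∀ {X Y} → X ≡ Y mod monic v₁ → h X ≈ h Y) → (∀ {X Y} → X ≡ Y mod monic v₂ → h X ≈ h Y) →
                   ∀ {X Y} → X ≡ Y mod monic e → h X ≈ h Y
    periodic-gcd h-periodic₁ h-periodic₂ X≡Y =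
      let Z , X≡Z , Z≡Y = ≡mod-combination {cofactorᴹ} {cofactorᴮ} {monic e} {monic v₁} {monic v₂} combination X≡Y
      in trans (h-periodic₁ X≡Z) (h-periodic₂ Z≡Y)

    fibre-balance : (h : Pol → Kᶜ) → (∀ {X Y} → X ≡ Y mod monic e → h X ≈ h Y) →
                    natMul c₂ (sumR (map h Rs₁)) ≈ natMul c₁ (sumR (map h Rs₂))
    fibre-balance h h-periodic = begin⟨ ACF0.setoid K ⟩
      natMul c₂ (sumR (map h Rs₁))                                   ≈⟨ natMul-sumR c₂ h Rs₁ ⟩
      sumR (map (λ R → natMul c₂ (h R)) Rs₁)                         ≈⟨ sumR-cong-All (rrs-units rrs₁) (fibre-size rrs₂ ∣B ∣monic) ⟨
      sumR (map (λ R → natMul (length (fibre e R Rs₂)) (h R)) Rs₁)   ≈⟨ fibre-sum-symmetric e commRing h h-periodic Rs₁ Rs₂ ⟩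
      sumR (map (λ S → natMul (length (fibre e S Rs₁)) (h S)) Rs₂)   ≈⟨ sumR-cong-All (rrs-units rrs₂) (fibre-size rrs₁ ∣monic ∣B) ⟩
      sumR (map (λ S → natMul c₁ (h S)) Rs₂)                         ≈⟨ natMul-sumR c₁ h Rs₂ ⟨
      natMul c₁ (sumR (map h Rs₂))                                   ∎
      where
      fibre-size : ∀ {n n'} {w : Vec Carrier n} {w' : Vec Carrier n'} {Ss} → ReducedResidueSystem w Ss →
                   monic e ∣ monic w → monic e ∣ monic w' → ∀ {R} → BezoutCoprime R (monic w') →
                   natMul (length (fibre e R Ss)) (h R) ≈ natMul (length (fibre e 1ₚ Ss)) (h R)
      fibre-size rrs D∣M D∣M' R⊥M' =
        ACF0.reflexive K (≡.cong (λ n → natMul n _) (fibre-length-constant rrs e D∣M (bezoutCoprime-∣ D∣M' R⊥M') 1-bezoutCoprime))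

    fibre-cardinalities : c₂ ℕ.* length Rs₁ ≡ c₁ ℕ.* length Rs₂
    fibre-cardinalities = natMul-1#-injective _ _ (begin⟨ ACF0.setoid K ⟩
      natMul (c₂ ℕ.* length Rs₁) 1#              ≈⟨ natMul-* c₂ (length Rs₁) 1# ⟩
      natMul c₂ (natMul (length Rs₁) 1#)          ≈⟨ natMul-cong c₂ (sumR-const Rs₁ 1#) ⟨
      natMul c₂ (sumR (map (λ _ → 1#) Rs₁))       ≈⟨ fibre-balance (λ _ → 1#) (λ _ → refl) ⟩
      natMul c₁ (sumR (map (λ _ → 1#) Rs₂))       ≈⟨ natMul-cong c₁ (sumR-const Rs₂ 1#) ⟩
      natMul c₁ (natMul (length Rs₂) 1#)          ≈⟨ natMul-* c₁ (length Rs₂) 1# ⟨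
      natMul (c₁ ℕ.* length Rs₂) 1#              ∎)

    fibre-nonempty-1 : 0 < c₁
    fibre-nonempty-1 = fibre-nonempty e (Any.map (≡mod-∣ ∣monic) (rrs-complete rrs₁ 1-bezoutCoprime))

  reducedResidueSums-balanced : ∀ {m₁ m₂} {v₁ : Vec Carrier m₁} {v₂ : Vec Carrier m₂} {Rs₁ Rs₂} →
    ReducedResidueSystem v₁ Rs₁ → ReducedResidueSystem v₂ Rs₂ → (g : Pol → Kᶜ) →
    (∀ {X Y} → X ≡ Y mod monic v₁ → g X ≈ g Y) → (∀ {X Y} → X ≡ Y mod monic v₂ → g X ≈ g Y) →
    natMul (length Rs₂) (sumR (map g Rs₁)) ≈ natMul (length Rs₁) (sumR (map g Rs₂))
  reducedResidueSums-balanced {v₁ = v₁} {v₂} {Rs₁} {Rs₂} rrs₁ rrs₂ g g-periodic₁ g-periodic₂ =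
    natMul-cross-cancel {length (fibre e 1ₚ Rs₁)} {length (fibre e 1ₚ Rs₂)} {length Rs₁} {length Rs₂} (fibre-nonempty-1 rrs₁ rrs₂ G)
      (fibre-balance rrs₁ rrs₂ G g (periodic-gcd rrs₁ rrs₂ G g-periodic₁ g-periodic₂)) (fibre-cardinalities rrs₁ rrs₂ G)
    where
    G = gcd v₁ (monic v₂)
    e = GCD.lower G

module AdditiveCharacterSums {c ℓ c' ℓ'} (F : FiniteField c ℓ) (K : ACF0 c' ℓ') (λ' : AddChar F K) where
  open FiniteField F using (Carrier)
  open Poly F
  open PolynomialRing F
  open MonicDivision F
  open ResidueSymmetry F
  open CommutativeRingCongruence polynomialRing
  open AddChar λ'
  open Sums F K λ'
  open ACF0 K using (_≈_; trans; sym)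

  E-periodic : ∀ {m} (v : Vec Carrier m) G {X Y} → X ≡ Y mod monic v → E G v X ≈ E G v Y
  E-periodic v G X≡Y = χ-cong (t-≡mod v (≡mod-*ˡ G X≡Y))

  E-swap : ∀ {m₁ m₂} (v₁ : Vec Carrier m₁) (v₂ : Vec Carrier m₂) {Q₁ Q₂ H} →
           (monic v₁ *ₚ Q₁) ≋ H → (monic v₂ *ₚ Q₂) ≋ H → ∀ X → E Q₂ v₁ X ≈ E Q₁ v₂ X
  E-swap v₁ v₂ M₁Q₁≋H M₂Q₂≋H X = χ-cong (t-swap v₁ v₂ X M₁Q₁≋H M₂Q₂≋H)

  E-periodic-cofactor : ∀ {m₁ m₂} (v₁ : Vec Carrier m₁) (v₂ : Vec Carrier m₂) {Q₁ Q₂ H} →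
                        (monic v₁ *ₚ Q₁) ≋ H → (monic v₂ *ₚ Q₂) ≋ H →
                        ∀ {X Y} → X ≡ Y mod monic v₂ → E Q₂ v₁ X ≈ E Q₂ v₁ Y
  E-periodic-cofactor v₁ v₂ {Q₁} M₁Q₁≋H M₂Q₂≋H {X} {Y} X≡Y =
    trans (E-swap v₁ v₂ M₁Q₁≋H M₂Q₂≋H X) (trans (E-periodic v₂ Q₁ X≡Y) (sym (E-swap v₁ v₂ M₁Q₁≋H M₂Q₂≋H Y)))

theorem3p2 : ∀ {c ℓ c' ℓ' : Level} (F : FiniteField c ℓ) (K : ACF0 c' ℓ') (λ' : AddChar F K)
               (H : Poly.Pol F) (m₁ m₂ : ℕ)
               (v₁ : Vec (FiniteField.Carrier F) m₁) (v₂ : Vec (FiniteField.Carrier F) m₂)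
               (Q₁ Q₂ : Poly.Pol F) →
               Poly._≈ₚ_ F (Poly._*ₚ_ F (Poly.monic F v₁) Q₁) H →
               Poly._≈ₚ_ F (Poly._*ₚ_ F (Poly.monic F v₂) Q₂) H →
               (Rs₁ Rs₂ : List (Poly.Pol F)) →
               Poly.ReducedResidueSystem F v₁ Rs₁ →
               Poly.ReducedResidueSystem F v₂ Rs₂ →
               ACF0._≈_ K
                 (ACF0.natMul K (Sums.φ F K λ' Rs₂) (Sums.η F K λ' Q₂ v₁ Rs₁))
                 (ACF0.natMul K (Sums.φ F K λ' Rs₁) (Sums.η F K λ' Q₁ v₂ Rs₂))
theorem3p2 F K λ' H m₁ m₂ v₁ v₂ Q₁ Q₂ M₁Q₁≈H M₂Q₂≈H Rs₁ Rs₂ rrs₁ rrs₂ =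
  ACF0.trans K
    (reducedResidueSums-balanced rrs₁ rrs₂ (E Q₂ v₁) (E-periodic v₁ Q₂) (E-periodic-cofactor v₁ v₂ M₁Q₁≋H M₂Q₂≋H))
    (natMul-cong (length Rs₁) (sumR-cong (E-swap v₁ v₂ M₁Q₁≋H M₂Q₂≋H) Rs₂))
  where
  open PolynomialRing F using (_≋_; mk≋)
  open ReducedResidueSums F K
  open AdditiveCharacterSums F K λ'
  open SumsAndMultiples (ACF0.commRing K)
  open Sums F K λ'
  M₁Q₁≋H : Poly._*ₚ_ F (Poly.monic F v₁) Q₁ ≋ H
  M₁Q₁≋H = mk≋ M₁Q₁≈H
  M₂Q₂≋H : Poly._*ₚ_ F (Poly.monic F v₂) Q₂ ≋ H
  M₂Q₂≋H = mk≋ M₂Q₂≈H
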